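{- For nonnegative integers $m,n$, let $C(K_{m,n})$ denote the number of compositions of the complete bipartite graph $K_{m,n}$. Then, as formal power series, \[\sum_{m,n=0}^{\infty} C(K_{m,n})\frac{x^m}{m!}\frac{y^n}{n!}=e^{(e^{x}-1)(e^{y}-1)+x+y}.\]
   Context: A composition of a labelled graph $G$ with vertex set $V(G)$ is a partition of $V(G)$ into (nonempty) blocks each of which is the vertex set of a connected induced subgraph of $G$; $C(G)$ denotes the number of compositions of $G$. $K_{m,n}$ is the complete bipartite graph with parts $X$, $Y$ of sizes $m$ and $n$ (every vertex of $X$ adjacent to every vertex of $Y$, no other edges); when $m=0$ or $n=0$ it has no edges, and $C(K_{0,0})=1$ (the empty partition). -}

module Defs where

open import Data.Nat using (ℕ; zero; suc; _+_; _∸_; _<_; _≤_; _!)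
open import Data.Nat.Properties using (_!≢0)
open import Data.Fin using (Fin; toℕ)
open import Data.Vec using (Vec; lookup)
open import Data.Bool using (Bool; T)
open import Data.List using (List; length)
open import Data.List.Relation.Unary.Unique.Propositional using (Unique)
open import Data.List.Membership.Propositional using (_∈_)
open import Data.Product using (Σ; _×_)
open import Data.Sum using (_⊎_)
open import Data.Integer using (+_)
open import Data.Rational using (ℚ; _/_; 0ℚ; 1ℚ) renaming (_+_ to _+q_; _*_ to _*q_; _-_ to _-q_)
open import Function.Bundles using (_⇔_)
open import Relation.Binary.PropositionalEquality using (_≡_)

record Graph : Set₁ where
  field
    N   : ℕ
    Adj : Fin N → Fin N → Set
open Graph public

-- K_{m,n}: vertex set Fin (m + n); X = {i | toℕ i < m}, Y = the rest.
K : ℕ → ℕ → Graph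
K m n = record
  { N   = m + n
  ; Adj = λ i j → (toℕ i < m × m ≤ toℕ j) ⊎ (m ≤ toℕ i × toℕ j < m) }

-- A walk from u to w in G all of whose vertices satisfy S
-- (i.e. a walk in the subgraph induced by S).
data WalkIn (G : Graph) (S : Fin (N G) → Set) : Fin (N G) → Fin (N G) → Set where
  here : ∀ {u} → S u → WalkIn G S u u
  step : ∀ {u v w} → S u → Adj G u v → WalkIn G S v w → WalkIn G S u w

-- Compositions.  A partition of the vertex set is represented by its
-- equivalence relation ("same block"), stored as a Boolean N×N matrix
-- (so that distinct partitions are distinct data).

Rel : ℕ → Set
Rel N = Vec (Vec Bool N) N

_∼[_]_ : ∀ {N} → Fin N → Rel N → Fin N → Set
i ∼[ r ] j = T (lookup (lookup r i) j)

IsEquivRel : ∀ {N} → Rel N → Set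
IsEquivRel {N} r =
  ((i : Fin N) → i ∼[ r ] i) ×
  ((i j : Fin N) → i ∼[ r ] j → j ∼[ r ] i) ×
  ((i j k : Fin N) → i ∼[ r ] j → j ∼[ r ] k → i ∼[ r ] k)

IsComposition : (G : Graph) → Rel (N G) → Set
IsComposition G r =
  IsEquivRel r ×
  ((u v : Fin (N G)) → u ∼[ r ] v → WalkIn G (λ w → u ∼[ r ] w) u v)

HasCount : {A : Set} → (A → Set) → ℕ → Set
HasCount {A} P c =
  Σ (List A) λ xs → (length xs ≡ c) × Unique xs × ((x : A) → (x ∈ xs) ⇔ P x)

-- Formal power series in x, y over ℚ:  f m n = [x^m y^n] f.

PS : Set
PS = ℕ → ℕ → ℚ

sumTo : ℕ → (ℕ → ℚ) → ℚ
sumTo zero    f = f zero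
sumTo (suc n) f = sumTo n f +q f (suc n)

_⊕_ : PS → PS → PS
(f ⊕ g) m n = f m n +q g m n

_⊖_ : PS → PS → PS
(f ⊖ g) m n = f m n -q g m n

_⊗_ : PS → PS → PS
(f ⊗ g) m n = sumTo m λ i → sumTo n λ j → f i j *q g (m ∸ i) (n ∸ j)

one : PS
one zero zero = 1ℚ
one _    _    = 0ℚ

X : PS
X (suc zero) zero = 1ℚ
X _          _    = 0ℚ

Y : PS
Y zero (suc zero) = 1ℚ
Y _    _          = 0ℚ

pow : PS → ℕ → PS
pow f zero    = one
pow f (suc k) = f ⊗ pow f k

invFact : ℕ → ℚ
invFact k = (+ 1 / (k !)) {{k !≢0}}

expX : PS
expX m zero    = invFact m
expX m (suc _) = 0ℚ

expY : PS
expY zero    n = invFact n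
expY (suc _) n = 0ℚ

-- exp(f) = Σ_k f^k / k!  for a series f with zero constant term; for such f
-- the terms with k > m + n do not contribute to [x^m y^n], so the sum is finite.
expS : PS → PS
expS f m n = sumTo (m + n) λ k → pow f k m n *q invFact k

F : PS
F = (((expX ⊖ one) ⊗ (expY ⊖ one)) ⊕ X) ⊕ Y

-- A block of a composition induces a connected
-- K_{a,b}: a single vertex, or a,b ≥ 1; with conn a b the indicator of this,
-- F = (eˣ-1)(eʸ-1) + x + y has coefficients conn a b / (a! b!).  Both sides of
-- the theorem obey the recurrences got by removing the block of an x-vertex,
-- resp. of a y-vertex:
--   count (m+1) n = (∂x conn ⋆ count) m n,   count m (n+1) = (∂y conn ⋆ count) m n,
-- with ⋆ the binomial convolution (product of exponential generating functions)
-- and ∂x, ∂y the index shifts.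
-- Algebraic half: ⋆ is commutative and associative and ∂x, ∂y are derivations,
-- so connᵏ = k!·blocks k for the block-recursive blocks k; count = Σₖ blocks k
-- satisfies the recurrences, and over ℚ, exp F = Σₖ Fᵏ/k! has coefficients count/(m! n!).
-- Combinatorial half: for any 2-colouring of the vertices, the partitions whose
-- blocks are singletons or meet both colours are listed without repetition by
-- choosing the block of the first vertex; the list has length count #x #y.
-- For K_{m,n} these partitions are exactly the compositions.

module Submission where

open import Defs
open import Data.Nat using (ℕ; zero; suc; _+_; _*_; _∸_; _≤_; _<_; _<ᵇ_; z≤n; s≤s; _!; NonZero)
open import Data.Nat.Properties
open import Data.Bool using (Bool; true; false; if_then_else_; T) renaming (_≟_ to _≟ᵇ_)
open import Data.Bool.Properties using (T-≡)
open import Data.Unit using (tt)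
open import Data.Empty using (⊥; ⊥-elim)
open import Data.Product using (Σ; _×_; _,_; proj₁; proj₂)
open import Data.Sum using (_⊎_; inj₁; inj₂)
open import Data.Fin using (Fin; toℕ; _↑ˡ_; _↑ʳ_; splitAt) renaming (_≟_ to _≟ᶠ_)
open import Data.Fin.Properties using (toℕ-↑ˡ; toℕ-↑ʳ; toℕ<n; splitAt⁻¹-↑ˡ; splitAt⁻¹-↑ʳ; ↑ˡ-injective; ↑ʳ-injective)
open import Data.Vec using (Vec; lookup; tabulate)
open import Data.Vec.Properties using (lookup∘tabulate; tabulate∘lookup; tabulate-cong)
open import Data.List using (List; []; _∷_; length; map; _++_; allFin)
open import Data.List.Properties using (length-map; length-++; length-tabulate)
open import Data.List.Membership.Propositional using (_∈_)
open import Data.List.Membership.Propositional.Properties using (∈-map⁻; ∈-map⁺; ∈-++⁻; ∈-++⁺ˡ; ∈-++⁺ʳ; ∈-allFin)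
open import Data.List.Relation.Unary.Any using (here; there)
open import Data.List.Relation.Unary.AllPairs using ([]; _∷_)
import Data.List.Relation.Unary.All as All
open import Data.List.Relation.Unary.Unique.Propositional using (Unique)
open import Data.List.Relation.Unary.Unique.Propositional.Properties using (++⁺; map⁺; allFin⁺)
open import Data.List.Relation.Binary.Disjoint.Propositional using (Disjoint)
open import Relation.Nullary using (¬_; Dec; yes; no)
open import Relation.Nullary.Decidable using (⌊_⌋; toWitness; fromWitness; T?; ¬?; _×-dec_; _⊎-dec_)
open import Data.Nat.Combinatorics using (_C_; nCk≡n!/k![n-k]!; k>n⇒nCk≡0; k![n∸k]!∣n!; nCk+nC[k+1]≡[n+1]C[k+1])
open import Data.Nat.DivMod using (m/n*n≡m)
open import Data.Nat.Tactic.RingSolver using (solve-∀)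
open import Data.Integer using (+_)
import Data.Integer as ℤ
import Data.Integer.Properties as ℤP
open import Data.Rational using (ℚ; _/_; 0ℚ; toℚᵘ) renaming (_+_ to _+q_; _*_ to _*q_)
import Data.Rational.Properties as ℚP
import Data.Rational.Unnormalised as ℚᵘ
import Data.Rational.Unnormalised.Properties as ℚᵘP
open import Relation.Binary.PropositionalEquality
open import Function using (case_of_; _∘_)
open import Function.Bundles using (mk⇔; Equivalence)

-- Double sequences of naturals; a : DSeq stands for the exponential
-- generating function  Σ a m n · xᵐ yⁿ / (m! n!).
DSeq : Set
DSeq = ℕ → ℕ → ℕ

infix 4 _≗₂_
_≗₂_ : DSeq → DSeq → Set
a ≗₂ b = ∀ m n → a m n ≡ b m n

-- splitSum m φ sums φ |A| |B| over all ordered splittings A ⊎ B of an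
-- m-element labelled set, i.e. it is  Σ_{i+k=m} (m choose i) · φ i k.
-- It is defined by deciding the side of one element, which makes the
-- Leibniz rule for the shift operators below hold by definition.
splitSum : ℕ → (ℕ → ℕ → ℕ) → ℕ
splitSum zero    φ = φ 0 0
splitSum (suc m) φ = splitSum m (λ i k → φ (suc i) k) + splitSum m (λ i k → φ i (suc k))

splitSum-cong-on : ∀ m {φ ψ : ℕ → ℕ → ℕ} →
  (∀ i k → i + k ≡ m → φ i k ≡ ψ i k) → splitSum m φ ≡ splitSum m ψ
splitSum-cong-on zero    h = h 0 0 refl
splitSum-cong-on (suc m) h = cong₂ _+_
  (splitSum-cong-on m (λ i k e → h (suc i) k (cong suc e)))
  (splitSum-cong-on m (λ i k e → h i (suc k) (trans (+-suc i k) (cong suc e))))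

splitSum-cong : ∀ m {φ ψ : ℕ → ℕ → ℕ} → (∀ i k → φ i k ≡ ψ i k) → splitSum m φ ≡ splitSum m ψ
splitSum-cong m h = splitSum-cong-on m (λ i k _ → h i k)

interchange : ∀ a b c d → (a + b) + (c + d) ≡ (a + c) + (b + d)
interchange = solve-∀

splitSum-+ : ∀ m (φ ψ : ℕ → ℕ → ℕ) →
  splitSum m (λ i k → φ i k + ψ i k) ≡ splitSum m φ + splitSum m ψ
splitSum-+ zero    φ ψ = refl
splitSum-+ (suc m) φ ψ =
  trans (cong₂ _+_ (splitSum-+ m (λ i k → φ (suc i) k) (λ i k → ψ (suc i) k))
                   (splitSum-+ m (λ i k → φ i (suc k)) (λ i k → ψ i (suc k))))
        (interchange (splitSum m (λ i k → φ (suc i) k)) (splitSum m (λ i k → ψ (suc i) k))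
                     (splitSum m (λ i k → φ i (suc k))) (splitSum m (λ i k → ψ i (suc k))))

splitSum-*ˡ : ∀ m c (φ : ℕ → ℕ → ℕ) → splitSum m (λ i k → c * φ i k) ≡ c * splitSum m φ
splitSum-*ˡ zero    c φ = refl
splitSum-*ˡ (suc m) c φ =
  trans (cong₂ _+_ (splitSum-*ˡ m c (λ i k → φ (suc i) k)) (splitSum-*ˡ m c (λ i k → φ i (suc k))))
        (sym (*-distribˡ-+ c (splitSum m (λ i k → φ (suc i) k)) (splitSum m (λ i k → φ i (suc k)))))

splitSum-*ʳ : ∀ m c (φ : ℕ → ℕ → ℕ) → splitSum m (λ i k → φ i k * c) ≡ splitSum m φ * c
splitSum-*ʳ m c φ =
  trans (splitSum-cong m (λ i k → *-comm (φ i k) c)) (trans (splitSum-*ˡ m c φ) (*-comm c _))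

splitSum-zero : ∀ m → splitSum m (λ _ _ → 0) ≡ 0
splitSum-zero m = splitSum-*ˡ m 0 (λ _ _ → 0)

splitSum-swap : ∀ m (φ : ℕ → ℕ → ℕ) → splitSum m φ ≡ splitSum m (λ i k → φ k i)
splitSum-swap zero    φ = refl
splitSum-swap (suc m) φ =
  trans (cong₂ _+_ (splitSum-swap m (λ i k → φ (suc i) k)) (splitSum-swap m (λ i k → φ i (suc k))))
        (+-comm (splitSum m (λ i k → φ (suc k) i)) (splitSum m (λ i k → φ k (suc i))))

splitSum-exchange : ∀ m n (ψ : ℕ → ℕ → ℕ → ℕ → ℕ) →
  splitSum m (λ i k → splitSum n (λ j l → ψ i k j l)) ≡
  splitSum n (λ j l → splitSum m (λ i k → ψ i k j l))
splitSum-exchange zero    n ψ = refl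
splitSum-exchange (suc m) n ψ =
  trans (cong₂ _+_ (splitSum-exchange m n (λ i k → ψ (suc i) k))
                   (splitSum-exchange m n (λ i k → ψ i (suc k))))
        (sym (splitSum-+ n _ _))

-- Associativity: splitting into (A ⊎ B) ⊎ C or into A ⊎ (B ⊎ C).
splitSum-assoc : ∀ m (ψ : ℕ → ℕ → ℕ → ℕ) →
  splitSum m (λ i k → splitSum i (λ a b → ψ a b k)) ≡
  splitSum m (λ a r → splitSum r (λ b k → ψ a b k))
splitSum-assoc zero    ψ = refl
splitSum-assoc (suc m) ψ = begin
  splitSum m (λ i k → splitSum (suc i) (λ a b → ψ a b k)) + splitSum m (λ i k → splitSum i (λ a b → ψ a b (suc k)))
    ≡⟨ cong (_+ C₁) (splitSum-+ m (λ i k → splitSum i (λ a b → ψ (suc a) b k))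
                                  (λ i k → splitSum i (λ a b → ψ a (suc b) k))) ⟩
  (A₁ + B₁) + C₁
    ≡⟨ cong₂ _+_ (cong₂ _+_ (splitSum-assoc m (λ a → ψ (suc a))) (splitSum-assoc m (λ a b → ψ a (suc b))))
                 (splitSum-assoc m (λ a b k → ψ a b (suc k))) ⟩
  (A₂ + B₂) + C₂
    ≡⟨ +-assoc A₂ B₂ C₂ ⟩
  A₂ + (B₂ + C₂)
    ≡⟨ cong (_+_ A₂) (splitSum-+ m (λ a r → splitSum r (λ b k → ψ a (suc b) k))
                                  (λ a r → splitSum r (λ b k → ψ a b (suc k)))) ⟨
  splitSum m (λ a r → splitSum r (λ b k → ψ (suc a) b k)) + splitSum m (λ a r → splitSum (suc r) (λ b k → ψ a b k)) ∎
  where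
  open ≡-Reasoning
  A₁ B₁ C₁ A₂ B₂ C₂ : ℕ
  A₁ = splitSum m (λ i k → splitSum i (λ a b → ψ (suc a) b k))
  B₁ = splitSum m (λ i k → splitSum i (λ a b → ψ a (suc b) k))
  C₁ = splitSum m (λ i k → splitSum i (λ a b → ψ a b (suc k)))
  A₂ = splitSum m (λ a r → splitSum r (λ b k → ψ (suc a) b k))
  B₂ = splitSum m (λ a r → splitSum r (λ b k → ψ a (suc b) k))
  C₂ = splitSum m (λ a r → splitSum r (λ b k → ψ a b (suc k)))

-- Splitting a bipartite labelled set (m elements on the x-side, n on the
-- y-side): the two splittings are independent.
Fn4 : Set
Fn4 = ℕ → ℕ → ℕ → ℕ → ℕ

splitSum₂ : ℕ → ℕ → Fn4 → ℕ
splitSum₂ m n φ = splitSum m (λ i k → splitSum n (λ j l → φ i j k l))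

splitSum₂-cong-on : ∀ m n {φ ψ : Fn4} →
  (∀ i j k l → i + k ≡ m → j + l ≡ n → φ i j k l ≡ ψ i j k l) → splitSum₂ m n φ ≡ splitSum₂ m n ψ
splitSum₂-cong-on m n h = splitSum-cong-on m (λ i k e → splitSum-cong-on n (λ j l e' → h i j k l e e'))

splitSum₂-cong : ∀ m n {φ ψ : Fn4} → (∀ i j k l → φ i j k l ≡ ψ i j k l) → splitSum₂ m n φ ≡ splitSum₂ m n ψ
splitSum₂-cong m n h = splitSum₂-cong-on m n (λ i j k l _ _ → h i j k l)

splitSum₂-sucʸ : ∀ m n (φ : Fn4) → splitSum₂ m (suc n) φ ≡
  splitSum₂ m n (λ i j k l → φ i (suc j) k l) + splitSum₂ m n (λ i j k l → φ i j k (suc l))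
splitSum₂-sucʸ m n φ = splitSum-+ m _ _

splitSum₂-+ : ∀ m n (φ ψ : Fn4) →
  splitSum₂ m n (λ i j k l → φ i j k l + ψ i j k l) ≡ splitSum₂ m n φ + splitSum₂ m n ψ
splitSum₂-+ m n φ ψ =
  trans (splitSum-cong m (λ i k → splitSum-+ n (λ j l → φ i j k l) (λ j l → ψ i j k l))) (splitSum-+ m _ _)

splitSum₂-*ˡ : ∀ m n c (φ : Fn4) → splitSum₂ m n (λ i j k l → c * φ i j k l) ≡ c * splitSum₂ m n φ
splitSum₂-*ˡ m n c φ =
  trans (splitSum-cong m (λ i k → splitSum-*ˡ n c (λ j l → φ i j k l))) (splitSum-*ˡ m c _)

splitSum₂-zero : ∀ m n → splitSum₂ m n (λ _ _ _ _ → 0) ≡ 0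
splitSum₂-zero m n = splitSum₂-*ˡ m n 0 (λ _ _ _ _ → 0)

-- The binomial convolution: the product of exponential generating functions.
infixl 7 _⋆_
_⋆_ : DSeq → DSeq → DSeq
(a ⋆ b) m n = splitSum₂ m n (λ i j k l → a i j * b k l)

⋆-cong : ∀ {a a′ b b′} → a ≗₂ a′ → b ≗₂ b′ → a ⋆ b ≗₂ a′ ⋆ b′
⋆-cong a≗a′ b≗b′ m n = splitSum₂-cong m n (λ i j k l → cong₂ _*_ (a≗a′ i j) (b≗b′ k l))

⋆-comm : ∀ a b → a ⋆ b ≗₂ b ⋆ a
⋆-comm a b m n =
  trans (splitSum-cong m (λ i k → splitSum-swap n (λ j l → a i j * b k l)))
  (trans (splitSum-swap m (λ i k → splitSum n (λ j l → a i l * b k j)))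
         (splitSum-cong m (λ i k → splitSum-cong n (λ j l → *-comm (a k l) (b i j)))))

⋆-assoc : ∀ a b c → (a ⋆ b) ⋆ c ≗₂ a ⋆ (b ⋆ c)
⋆-assoc a b c m n = begin
  ((a ⋆ b) ⋆ c) m n
    ≡⟨ splitSum-cong m (λ i k → splitSum-cong n (λ j l →
         trans (sym (splitSum-*ʳ i (c k l) _)) (splitSum-cong i (λ i′ k′ → sym (splitSum-*ʳ j (c k l) _))))) ⟩
  splitSum m (λ i k → splitSum n (λ j l → splitSum i (λ i′ k′ → splitSum j (λ j′ l′ → t i′ j′ k′ l′ k l))))
    ≡⟨ splitSum-cong m (λ i k → splitSum-exchange n i _) ⟩
  splitSum m (λ i k → splitSum i (λ i′ k′ → splitSum n (λ j l → splitSum j (λ j′ l′ → t i′ j′ k′ l′ k l))))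
    ≡⟨ splitSum-cong m (λ i k → splitSum-cong i (λ i′ k′ → splitSum-assoc n (λ j′ l′ l → t i′ j′ k′ l′ k l))) ⟩
  splitSum m (λ i k → splitSum i (λ i′ k′ → splitSum n (λ j′ r → splitSum r (λ l′ l → t i′ j′ k′ l′ k l))))
    ≡⟨ splitSum-assoc m (λ i′ k′ k → splitSum n (λ j′ r → splitSum r (λ l′ l → t i′ j′ k′ l′ k l))) ⟩
  splitSum m (λ i′ r → splitSum r (λ k′ k → splitSum n (λ j′ r′ → splitSum r′ (λ l′ l → t i′ j′ k′ l′ k l))))
    ≡⟨ splitSum-cong m (λ i′ r → splitSum-exchange r n _) ⟩
  splitSum m (λ i′ r → splitSum n (λ j′ r′ → splitSum r (λ k′ k → splitSum r′ (λ l′ l → t i′ j′ k′ l′ k l))))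
    ≡⟨ splitSum-cong m (λ i′ r → splitSum-cong n (λ j′ r′ →
         trans (splitSum-cong r (λ k′ k → trans (splitSum-cong r′ (λ l′ l → *-assoc (a i′ j′) (b k′ l′) (c k l)))
                                               (splitSum-*ˡ r′ (a i′ j′) _)))
               (splitSum-*ˡ r (a i′ j′) _))) ⟩
  (a ⋆ (b ⋆ c)) m n ∎
  where
  open ≡-Reasoning
  t : ℕ → ℕ → ℕ → ℕ → ℕ → ℕ → ℕ
  t i′ j′ k′ l′ k l = a i′ j′ * b k′ l′ * c k l

⋆-left-comm : ∀ a b c → a ⋆ (b ⋆ c) ≗₂ b ⋆ (a ⋆ c)
⋆-left-comm a b c m n = begin
  (a ⋆ (b ⋆ c)) m n  ≡⟨ ⋆-assoc a b c m n ⟨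
  ((a ⋆ b) ⋆ c) m n  ≡⟨ ⋆-cong (⋆-comm a b) (λ _ _ → refl) m n ⟩
  ((b ⋆ a) ⋆ c) m n  ≡⟨ ⋆-assoc b a c m n ⟩
  (b ⋆ (a ⋆ c)) m n  ∎
  where open ≡-Reasoning

⋆-*ʳ : ∀ a b c → a ⋆ (λ m n → c * b m n) ≗₂ (λ m n → c * (a ⋆ b) m n)
⋆-*ʳ a b c m n =
  trans (splitSum₂-cong m n (λ i j k l → x*[y*z]≡y*[x*z] (a i j) c (b k l))) (splitSum₂-*ˡ m n c _)
  where
  x*[y*z]≡y*[x*z] : ∀ x y z → x * (y * z) ≡ y * (x * z)
  x*[y*z]≡y*[x*z] = solve-∀

⋆-zeroʳ : ∀ a z → z ≗₂ (λ _ _ → 0) → a ⋆ z ≗₂ (λ _ _ → 0)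
⋆-zeroʳ a z z≗0 m n =
  trans (splitSum₂-cong m n (λ i j k l → trans (cong (a i j *_) (z≗0 k l)) (*-zeroʳ (a i j))))
        (splitSum₂-zero m n)

unit : DSeq
unit zero    zero    = 1
unit zero    (suc _) = 0
unit (suc _) _       = 0

pow⋆ : DSeq → ℕ → DSeq
pow⋆ g zero    = unit
pow⋆ g (suc k) = g ⋆ pow⋆ g k

module PowerRule (D : DSeq → DSeq)
  (D-cong : ∀ {a b} → a ≗₂ b → D a ≗₂ D b)
  (leibniz : ∀ a b → D (a ⋆ b) ≗₂ (λ m n → (D a ⋆ b) m n + (a ⋆ D b) m n))
  (D-unit : D unit ≗₂ (λ _ _ → 0)) where

  power-rule : ∀ g k → D (pow⋆ g (suc k)) ≗₂ (λ m n → suc k * (D g ⋆ pow⋆ g k) m n)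
  power-rule g zero m n =
    trans (leibniz g unit m n) (cong (_+_ ((D g ⋆ unit) m n)) (⋆-zeroʳ g (D unit) D-unit m n))
  power-rule g (suc k) m n = begin
    D (g ⋆ pow⋆ g (suc k)) m n
      ≡⟨ leibniz g (pow⋆ g (suc k)) m n ⟩
    (D g ⋆ pow⋆ g (suc k)) m n + (g ⋆ D (pow⋆ g (suc k))) m n
      ≡⟨ cong (_+_ first) (⋆-cong {g} (λ _ _ → refl) (power-rule g k) m n) ⟩
    (D g ⋆ pow⋆ g (suc k)) m n + (g ⋆ (λ m n → suc k * (D g ⋆ pow⋆ g k) m n)) m n
      ≡⟨ cong (_+_ first) (⋆-*ʳ g (D g ⋆ pow⋆ g k) (suc k) m n) ⟩
    (D g ⋆ pow⋆ g (suc k)) m n + suc k * (g ⋆ (D g ⋆ pow⋆ g k)) m n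
      ≡⟨ cong (λ t → first + suc k * t) (⋆-left-comm g (D g) (pow⋆ g k) m n) ⟩
    suc (suc k) * (D g ⋆ pow⋆ g (suc k)) m n ∎
    where
    open ≡-Reasoning
    first : ℕ
    first = (D g ⋆ pow⋆ g (suc k)) m n

-- The partial derivatives ∂/∂x and ∂/∂y act on exponential generating
-- functions as index shifts; both are derivations.
∂x ∂y : DSeq → DSeq
∂x a m n = a (suc m) n
∂y a m n = a m (suc n)

module ∂x-Power = PowerRule ∂x (λ a≗b m n → a≗b (suc m) n) (λ a b m n → refl) (λ m n → refl)

∂y-unit : ∂y unit ≗₂ (λ _ _ → 0)
∂y-unit zero    n = refl
∂y-unit (suc m) n = refl

module ∂y-Power = PowerRule ∂y (λ a≗b m n → a≗b m (suc n))
  (λ a b m n → splitSum₂-sucʸ m n (λ i j k l → a i j * b k l)) ∂y-unit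

-- K_{a,b} has a connected nonempty vertex set iff it is a single vertex or
-- both sides are nonempty.
connectedK : ℕ → ℕ → Bool
connectedK zero          zero          = false
connectedK zero          (suc zero)    = true
connectedK zero          (suc (suc _)) = false
connectedK (suc _)       (suc _)       = true
connectedK (suc zero)    zero          = true
connectedK (suc (suc _)) zero          = false

true≢false : true ≢ false
true≢false ()

connectedK-cases : ∀ a b → T (connectedK a b) →
  a + b ≡ 1 ⊎ Σ ℕ λ a′ → Σ ℕ λ b′ → a ≡ suc a′ × b ≡ suc b′
connectedK-cases zero       (suc zero) _ = inj₁ refl
connectedK-cases (suc zero) zero       _ = inj₁ refl
connectedK-cases (suc a)    (suc b)    _ = inj₂ (a , b , refl , refl)

connectedK-single : ∀ a b → a + b ≡ 1 → T (connectedK a b)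
connectedK-single zero       (suc zero) _ = tt
connectedK-single (suc zero) zero       _ = tt

-- The exponential generating function of the connected K_{m,n}: the
-- integer coefficients of the series F of the theorem.
conn : DSeq
conn m n = if connectedK m n then 1 else 0

-- blocks k m n is the number of compositions of K_{m,n} into k blocks,
-- counted by the block containing the first vertex (an x-vertex when
-- m > 0, a y-vertex otherwise) together with a composition of the rest.
blocks : ℕ → DSeq
blocks zero                = unit
blocks (suc k) (suc m) n   = (∂x conn ⋆ blocks k) m n
blocks (suc k) zero (suc n) = (∂y conn ⋆ blocks k) zero n
blocks (suc k) zero zero   = 0

⋆-factorial : ∀ g b c k → b ≗₂ (λ m n → k ! * c m n) →
  ∀ m n → suc k * (g ⋆ b) m n ≡ suc k ! * (g ⋆ c) m n
⋆-factorial g b c k b≗k!c m n = begin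
  suc k * (g ⋆ b) m n                        ≡⟨ cong (suc k *_) (⋆-cong {g} (λ _ _ → refl) b≗k!c m n) ⟩
  suc k * (g ⋆ (λ m n → k ! * c m n)) m n    ≡⟨ cong (suc k *_) (⋆-*ʳ g c (k !) m n) ⟩
  suc k * (k ! * (g ⋆ c) m n)                ≡⟨ *-assoc (suc k) (k !) ((g ⋆ c) m n) ⟨
  suc k ! * (g ⋆ c) m n                      ∎
  where open ≡-Reasoning

-- connᵏ = k!·blocks k: the k-th power of the series counts compositions
-- into k blocks together with an ordering of the blocks.
pow-conn : ∀ k → pow⋆ conn k ≗₂ (λ m n → k ! * blocks k m n)
pow-conn zero    m       n       = sym (+-identityʳ _)
pow-conn (suc k) (suc m) n       =
  trans (∂x-Power.power-rule conn k m n) (⋆-factorial (∂x conn) _ (blocks k) k (pow-conn k) m n)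
pow-conn (suc k) zero    (suc n) =
  trans (∂y-Power.power-rule conn k zero n) (⋆-factorial (∂y conn) _ (blocks k) k (pow-conn k) zero n)
pow-conn (suc k) zero    zero    = sym (*-zeroʳ (suc k !))

-- The recursion for blocks with respect to a y-vertex holds for every m,
-- not only m = 0: both sides are (k+1)!⁻¹ · ∂y (conn ᵏ⁺¹).
blocks-sucʸ : ∀ k m n → blocks (suc k) m (suc n) ≡ (∂y conn ⋆ blocks k) m n
blocks-sucʸ k m n = *-cancelˡ-≡ _ _ (suc k !) {{suc k !≢0}} (begin
  suc k ! * blocks (suc k) m (suc n)       ≡⟨ pow-conn (suc k) m (suc n) ⟨
  pow⋆ conn (suc k) m (suc n)             ≡⟨ ∂y-Power.power-rule conn k m n ⟩
  suc k * (∂y conn ⋆ pow⋆ conn k) m n      ≡⟨ ⋆-factorial (∂y conn) _ (blocks k) k (pow-conn k) m n ⟩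
  suc k ! * (∂y conn ⋆ blocks k) m n       ∎)
  where open ≡-Reasoning

sumℕ : ℕ → (ℕ → ℕ) → ℕ
sumℕ zero    g = g 0
sumℕ (suc n) g = sumℕ n g + g (suc n)

sumℕ-cong-on : ∀ n {g h : ℕ → ℕ} → (∀ i → i ≤ n → g i ≡ h i) → sumℕ n g ≡ sumℕ n h
sumℕ-cong-on zero    g≡h = g≡h 0 z≤n
sumℕ-cong-on (suc n) g≡h = cong₂ _+_ (sumℕ-cong-on n (λ i i≤n → g≡h i (m≤n⇒m≤1+n i≤n))) (g≡h (suc n) ≤-refl)

sumℕ-cong : ∀ n {g h : ℕ → ℕ} → (∀ i → g i ≡ h i) → sumℕ n g ≡ sumℕ n h
sumℕ-cong n g≡h = sumℕ-cong-on n (λ i _ → g≡h i)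

sumℕ-shift : ∀ n g → sumℕ (suc n) g ≡ g 0 + sumℕ n (λ i → g (suc i))
sumℕ-shift zero    g = refl
sumℕ-shift (suc n) g = trans (cong (_+ g (suc (suc n))) (sumℕ-shift n g)) (+-assoc (g 0) _ _)

sumℕ-+ : ∀ n (g h : ℕ → ℕ) → sumℕ n (λ i → g i + h i) ≡ sumℕ n g + sumℕ n h
sumℕ-+ zero    g h = refl
sumℕ-+ (suc n) g h =
  trans (cong (_+ (g (suc n) + h (suc n))) (sumℕ-+ n g h)) (interchange (sumℕ n g) (sumℕ n h) (g (suc n)) (h (suc n)))

sumℕ-*ˡ : ∀ n c (g : ℕ → ℕ) → sumℕ n (λ i → c * g i) ≡ c * sumℕ n g
sumℕ-*ˡ zero    c g = refl
sumℕ-*ˡ (suc n) c g =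
  trans (cong (_+ (c * g (suc n))) (sumℕ-*ˡ n c g)) (sym (*-distribˡ-+ c (sumℕ n g) (g (suc n))))

sumℕ-truncate : ∀ M K (g : ℕ → ℕ) → M ≤ K → (∀ k → M < k → g k ≡ 0) → sumℕ K g ≡ sumℕ M g
sumℕ-truncate M zero    g z≤n  g-vanishes = refl
sumℕ-truncate M (suc K) g M≤1+K g-vanishes with m≤n⇒m<n∨m≡n M≤1+K
... | inj₂ refl = refl
... | inj₁ M<1+K = begin
  sumℕ K g + g (suc K)  ≡⟨ cong (_+_ (sumℕ K g)) (g-vanishes (suc K) M<1+K) ⟩
  sumℕ K g + 0          ≡⟨ +-identityʳ _ ⟩
  sumℕ K g              ≡⟨ sumℕ-truncate M K g (≤-pred M<1+K) g-vanishes ⟩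
  sumℕ M g              ∎
  where open ≡-Reasoning

sumℕ-splitSum₂ : ∀ K m n (φ : ℕ → Fn4) →
  sumℕ K (λ k → splitSum₂ m n (φ k)) ≡ splitSum₂ m n (λ i j k′ l → sumℕ K (λ k → φ k i j k′ l))
sumℕ-splitSum₂ zero    m n φ = refl
sumℕ-splitSum₂ (suc K) m n φ =
  trans (cong (_+ splitSum₂ m n (φ (suc K))) (sumℕ-splitSum₂ K m n φ))
        (sym (splitSum₂-+ m n (λ i j k′ l → sumℕ K (λ k → φ k i j k′ l)) (φ (suc K))))

part≤whole : ∀ i {k m} → i + k ≡ m → k ≤ m
part≤whole i {k} i+k≡m = subst (k ≤_) i+k≡m (m≤n+m k i)

⋆-vanish : ∀ g b K → (∀ m n → m + n < K → b m n ≡ 0) → ∀ m n → m + n < K → (g ⋆ b) m n ≡ 0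
⋆-vanish g b K b-vanishes m n m+n<K = trans
  (splitSum₂-cong-on m n (λ i j k l i+k≡m j+l≡n →
    trans (cong (g i j *_) (b-vanishes k l (≤-<-trans (+-mono-≤ (part≤whole i i+k≡m) (part≤whole j j+l≡n)) m+n<K)))
          (*-zeroʳ (g i j))))
  (splitSum₂-zero m n)

blocks-vanish : ∀ k m n → m + n < k → blocks k m n ≡ 0
blocks-vanish (suc k) (suc m) n       (s≤s m+n<k) = ⋆-vanish (∂x conn) (blocks k) k (λ m n → blocks-vanish k m n) m n m+n<k
blocks-vanish (suc k) zero    (suc n) (s≤s n<k)   = ⋆-vanish (∂y conn) (blocks k) k (λ m n → blocks-vanish k m n) 0 n n<k
blocks-vanish (suc k) zero    zero    _           = refl

-- count m n is the number of compositions of K_{m,n}.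
count : DSeq
count m n = sumℕ (m + n) (λ k → blocks k m n)

⋆-count : ∀ g m n → sumℕ (m + n) (λ k → (g ⋆ blocks k) m n) ≡ (g ⋆ count) m n
⋆-count g m n =
  trans (sumℕ-splitSum₂ (m + n) m n (λ k i j k′ l → g i j * blocks k k′ l))
        (splitSum₂-cong-on m n (λ i j k′ l i+k′≡m j+l≡n →
          trans (sumℕ-*ˡ (m + n) (g i j) (λ k → blocks k k′ l))
                (cong (g i j *_) (sumℕ-truncate (k′ + l) (m + n) (λ k → blocks k k′ l)
                                   (+-mono-≤ (part≤whole i i+k′≡m) (part≤whole j j+l≡n)) (λ k → blocks-vanish k k′ l)))))

-- The recurrences for count obtained by removing the block of an x-vertex,
-- respectively of a y-vertex; they determine count completely.
count-sucˣ : ∀ m n → count (suc m) n ≡ (∂x conn ⋆ count) m n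
count-sucˣ m n = trans (sumℕ-shift (m + n) (λ k → blocks k (suc m) n)) (⋆-count (∂x conn) m n)

count-sucʸ : ∀ m n → count m (suc n) ≡ (∂y conn ⋆ count) m n
count-sucʸ m n = begin
  sumℕ (m + suc n) (λ k → blocks k m (suc n))
    ≡⟨ cong (λ t → sumℕ t (λ k → blocks k m (suc n))) (+-suc m n) ⟩
  sumℕ (suc (m + n)) (λ k → blocks k m (suc n))
    ≡⟨ sumℕ-shift (m + n) (λ k → blocks k m (suc n)) ⟩
  unit m (suc n) + sumℕ (m + n) (λ k → blocks (suc k) m (suc n))
    ≡⟨ cong₂ _+_ (∂y-unit m n) (sumℕ-cong (m + n) (λ k → blocks-sucʸ k m n)) ⟩
  sumℕ (m + n) (λ k → (∂y conn ⋆ blocks k) m n)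
    ≡⟨ ⋆-count (∂y conn) m n ⟩
  (∂y conn ⋆ count) m n ∎
  where open ≡-Reasoning

C*factorials : ∀ {n k} → k ≤ n → (n C k) * (k ! * (n ∸ k) !) ≡ n !
C*factorials {n} {k} k≤n =
  trans (cong (_* (k ! * (n ∸ k) !)) (nCk≡n!/k![n-k]! k≤n)) (m/n*n≡m {{k !* (n ∸ k) !≢0}} (k![n∸k]!∣n! k≤n))

-- splitSum m φ = Σ_{i ≤ m} (m choose i) · φ i (m - i): the binomial
-- coefficients arise through Pascal's rule.
splitSum-binomial : ∀ m (φ : ℕ → ℕ → ℕ) → splitSum m φ ≡ sumℕ m (λ i → (m C i) * φ i (m ∸ i))
splitSum-binomial zero    φ = sym (+-identityʳ _)
splitSum-binomial (suc m) φ = begin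
  splitSum m (λ i k → φ (suc i) k) + splitSum m (λ i k → φ i (suc k))
    ≡⟨ cong₂ _+_ (splitSum-binomial m (λ i k → φ (suc i) k)) (splitSum-binomial m (λ i k → φ i (suc k))) ⟩
  S₁ + sumℕ m (λ i → (m C i) * φ i (suc (m ∸ i)))
    ≡⟨ cong (_+_ S₁) (sumℕ-cong-on m (λ i i≤m → cong (λ t → (m C i) * φ i t) (sym (+-∸-assoc 1 i≤m)))) ⟩
  S₁ + sumℕ m h
    ≡⟨ cong (_+_ S₁) (sym (trans (cong (_+_ (sumℕ m h)) (cong (_* φ (suc m) (m ∸ m)) (k>n⇒nCk≡0 (n<1+n m)))) (+-identityʳ _))) ⟩
  S₁ + sumℕ (suc m) h
    ≡⟨ cong (_+_ S₁) (sumℕ-shift m h) ⟩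
  S₁ + (1 * φ 0 (suc m) + S₂)
    ≡⟨ x+[y+z]≡y+[x+z] S₁ (1 * φ 0 (suc m)) S₂ ⟩
  1 * φ 0 (suc m) + (S₁ + S₂)
    ≡⟨ cong (_+_ (1 * φ 0 (suc m))) (sym (sumℕ-+ m _ _)) ⟩
  1 * φ 0 (suc m) + sumℕ m (λ i → (m C i) * φ (suc i) (m ∸ i) + (m C suc i) * φ (suc i) (m ∸ i))
    ≡⟨ cong (_+_ (1 * φ 0 (suc m))) (sumℕ-cong m (λ i →
         trans (sym (*-distribʳ-+ (φ (suc i) (m ∸ i)) (m C i) (m C suc i)))
               (cong (_* φ (suc i) (m ∸ i)) (nCk+nC[k+1]≡[n+1]C[k+1] m i)))) ⟩
  1 * φ 0 (suc m) + sumℕ m (λ i → (suc m C suc i) * φ (suc i) (m ∸ i))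
    ≡⟨ sumℕ-shift m (λ i → (suc m C i) * φ i (suc m ∸ i)) ⟨
  sumℕ (suc m) (λ i → (suc m C i) * φ i (suc m ∸ i)) ∎
  where
  open ≡-Reasoning
  h : ℕ → ℕ
  h i = (m C i) * φ i (suc m ∸ i)
  S₁ S₂ : ℕ
  S₁ = sumℕ m (λ i → (m C i) * φ (suc i) (m ∸ i))
  S₂ = sumℕ m (λ i → (m C suc i) * φ (suc i) (m ∸ i))
  x+[y+z]≡y+[x+z] : ∀ x y z → x + (y + z) ≡ y + (x + z)
  x+[y+z]≡y+[x+z] = solve-∀

splitSum₂-binomial : ∀ m n (φ : Fn4) →
  splitSum₂ m n φ ≡ sumℕ m (λ i → sumℕ n (λ j → ((m C i) * (n C j)) * φ i j (m ∸ i) (n ∸ j)))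
splitSum₂-binomial m n φ =
  trans (splitSum-binomial m (λ i k → splitSum n (λ j l → φ i j k l)))
  (sumℕ-cong m (λ i → trans (cong ((m C i) *_) (splitSum-binomial n (λ j l → φ i j (m ∸ i) l)))
     (trans (sym (sumℕ-*ˡ n (m C i) (λ j → (n C j) * φ i j (m ∸ i) (n ∸ j))))
            (sumℕ-cong n (λ j → sym (*-assoc (m C i) (n C j) _))))))

-- Fractions of naturals.  Equalities of fractions are checked in the
-- unnormalised rationals, where they reduce to cross-multiplication in ℕ.
toℚᵘ-/ : ∀ a x → toℚᵘ (+ a / suc x) ℚᵘ.≃ ℚᵘ.mkℚᵘ (+ a) x
toℚᵘ-/ a x = ℚP.toℚᵘ-fromℚᵘ (ℚᵘ.mkℚᵘ (+ a) x)

ℤ-cross : ∀ a b c d → a * b ≡ c * d → + a ℤ.* + b ≡ + c ℤ.* + d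
ℤ-cross a b c d eq = trans (sym (ℤP.pos-* a b)) (trans (cong +_ eq) (ℤP.pos-* c d))

fraction-cong : ∀ a a′ d d′ {{_ : NonZero d}} {{_ : NonZero d′}} → a * d′ ≡ a′ * d → + a / d ≡ + a′ / d′
fraction-cong a a′ (suc x) (suc x′) eq = ℚP.toℚᵘ-injective
  (ℚᵘP.≃-trans (toℚᵘ-/ a x) (ℚᵘP.≃-trans (ℚᵘ.*≡* (ℤ-cross a (suc x′) a′ (suc x) eq)) (ℚᵘP.≃-sym (toℚᵘ-/ a′ x′))))

fraction-* : ∀ a b e d₁ d₂ d {{_ : NonZero d₁}} {{_ : NonZero d₂}} {{_ : NonZero d}} →
  (a * b) * d ≡ e * (d₁ * d₂) → (+ a / d₁) *q (+ b / d₂) ≡ + e / d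
fraction-* a b e (suc x₁) (suc x₂) (suc x) eq = ℚP.toℚᵘ-injective
  (ℚᵘP.≃-trans (ℚP.toℚᵘ-homo-* (+ a / suc x₁) (+ b / suc x₂))
  (ℚᵘP.≃-trans (ℚᵘP.*-cong (toℚᵘ-/ a x₁) (toℚᵘ-/ b x₂))
  (ℚᵘP.≃-trans (ℚᵘ.*≡* cross) (ℚᵘP.≃-sym (toℚᵘ-/ e x)))))
  where
  cross : (+ a ℤ.* + b) ℤ.* + suc x ≡ + e ℤ.* (+ (suc x₁ * suc x₂))
  cross = trans (cong (ℤ._* + suc x) (sym (ℤP.pos-* a b))) (ℤ-cross (a * b) (suc x) e (suc x₁ * suc x₂) eq)

fraction-+ : ∀ a b d {{_ : NonZero d}} → (+ a / d) +q (+ b / d) ≡ + (a + b) / d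
fraction-+ a b (suc x) = ℚP.toℚᵘ-injective
  (ℚᵘP.≃-trans (ℚP.toℚᵘ-homo-+ (+ a / suc x) (+ b / suc x))
  (ℚᵘP.≃-trans (ℚᵘP.+-cong (toℚᵘ-/ a x) (toℚᵘ-/ b x))
  (ℚᵘP.≃-trans (ℚᵘ.*≡* cross) (ℚᵘP.≃-sym (toℚᵘ-/ (a + b) x)))))
  where
  d = suc x
  cross : (+ a ℤ.* + d ℤ.+ + b ℤ.* + d) ℤ.* + d ≡ + (a + b) ℤ.* (+ (d * d))
  cross = trans (cong (ℤ._* + d) (trans (cong₂ ℤ._+_ (sym (ℤP.pos-* a d)) (sym (ℤP.pos-* b d)))
                                         (sym (ℤP.pos-+ (a * d) (b * d)))))
                (ℤ-cross (a * d + b * d) d (a + b) (d * d) (distrib a b d))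
    where
    distrib : ∀ a b d → (a * d + b * d) * d ≡ (a + b) * (d * d)
    distrib = solve-∀

sumTo-cong-on : ∀ n {g h : ℕ → ℚ} → (∀ i → i ≤ n → g i ≡ h i) → sumTo n g ≡ sumTo n h
sumTo-cong-on zero    g≡h = g≡h 0 z≤n
sumTo-cong-on (suc n) g≡h = cong₂ _+q_ (sumTo-cong-on n (λ i i≤n → g≡h i (m≤n⇒m≤1+n i≤n))) (g≡h (suc n) ≤-refl)

sumTo-fraction : ∀ n (g : ℕ → ℕ) d {{_ : NonZero d}} → sumTo n (λ i → + g i / d) ≡ + sumℕ n g / d
sumTo-fraction zero    g d = refl
sumTo-fraction (suc n) g d =
  trans (cong (_+q (+ g (suc n) / d)) (sumTo-fraction n g d)) (fraction-+ (sumℕ n g) (g (suc n)) d)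

egf : DSeq → PS
egf a m n = (+ a m n / (m ! * n !)) {{m !* n !≢0}}

_≈egf_ : PS → DSeq → Set
f ≈egf a = ∀ m n → f m n ≡ egf a m n

egf-+ : ∀ a b m n → egf a m n +q egf b m n ≡ egf (λ m n → a m n + b m n) m n
egf-+ a b m n = fraction-+ (a m n) (b m n) (m ! * n !) {{m !* n !≢0}}

egf-term : ∀ a b {m n i j} → i ≤ m → j ≤ n →
  egf a i j *q egf b (m ∸ i) (n ∸ j) ≡
  (+ (((m C i) * (n C j)) * (a i j * b (m ∸ i) (n ∸ j))) / (m ! * n !)) {{m !* n !≢0}}
egf-term a b {m} {n} {i} {j} i≤m j≤n =
  fraction-* (a i j) (b (m ∸ i) (n ∸ j)) (((m C i) * (n C j)) * (a i j * b (m ∸ i) (n ∸ j))) (i ! * j !) ((m ∸ i) ! * (n ∸ j) !) (m ! * n !)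
    {{i !* j !≢0}} {{(m ∸ i) !* (n ∸ j) !≢0}} {{m !* n !≢0}}
    (trans (cong₂ (λ u v → (a i j * b (m ∸ i) (n ∸ j)) * (u * v)) (sym (C*factorials i≤m)) (sym (C*factorials j≤n)))
           (rearrange (a i j) (b (m ∸ i) (n ∸ j)) (m C i) (n C j) (i !) (j !) ((m ∸ i) !) ((n ∸ j) !)))
  where
  rearrange : ∀ A B cm cn fi fj fmi fnj → (A * B) * ((cm * (fi * fmi)) * (cn * (fj * fnj)))
                                        ≡ ((cm * cn) * (A * B)) * ((fi * fj) * (fmi * fnj))
  rearrange = solve-∀

egf-⊗ : ∀ {g h : PS} a b → g ≈egf a → h ≈egf b → (g ⊗ h) ≈egf (a ⋆ b)
egf-⊗ {g} {h} a b g≈a h≈b m n = begin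
  sumTo m (λ i → sumTo n (λ j → g i j *q h (m ∸ i) (n ∸ j)))
    ≡⟨ sumTo-cong-on m (λ i i≤m → sumTo-cong-on n (λ j j≤n →
         trans (cong₂ _*q_ (g≈a i j) (h≈b (m ∸ i) (n ∸ j))) (egf-term a b i≤m j≤n))) ⟩
  sumTo m (λ i → sumTo n (λ j → + term i j / d))
    ≡⟨ sumTo-cong-on m (λ i _ → sumTo-fraction n (term i) d) ⟩
  sumTo m (λ i → + sumℕ n (term i) / d)
    ≡⟨ sumTo-fraction m (λ i → sumℕ n (term i)) d ⟩
  + sumℕ m (λ i → sumℕ n (term i)) / d
    ≡⟨ cong (λ t → + t / d) (splitSum₂-binomial m n (λ i j k l → a i j * b k l)) ⟨
  egf (a ⋆ b) m n ∎
  where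
  open ≡-Reasoning
  d : ℕ
  d = m ! * n !
  instance
    d≢0 : NonZero d
    d≢0 = m !* n !≢0
  term : ℕ → ℕ → ℕ
  term i j = ((m C i) * (n C j)) * (a i j * b (m ∸ i) (n ∸ j))

expm1X expm1Y varX varY : DSeq
expm1X (suc _) zero = 1
expm1X _       _    = 0
expm1Y zero (suc _) = 1
expm1Y _    _       = 0
varX (suc zero) zero = 1
varX _          _    = 0
varY zero (suc zero) = 1
varY _    _          = 0

zero-fraction : ∀ d {{_ : NonZero d}} → 0ℚ ≡ + 0 / d
zero-fraction d = sym (ℚP.0/n≡0 d)

unit-fraction : ∀ d d′ {{_ : NonZero d}} {{_ : NonZero d′}} → d ≡ d′ → + 1 / d ≡ + 1 / d′
unit-fraction d d′ d≡d′ = fraction-cong 1 1 d d′ (cong (1 *_) (sym d≡d′))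

expm1X-egf : (expX ⊖ one) ≈egf expm1X
expm1X-egf zero    zero    = refl
expm1X-egf zero    (suc j) = zero-fraction (1 * suc j !) {{1 !* suc j !≢0}}
expm1X-egf (suc i) zero    = trans (ℚP.+-identityʳ (invFact (suc i)))
  (unit-fraction (suc i !) (suc i ! * 1) {{suc i !≢0}} {{suc i !* 0 !≢0}} (sym (*-identityʳ _)))
expm1X-egf (suc i) (suc j) = zero-fraction (suc i ! * suc j !) {{suc i !* suc j !≢0}}

expm1Y-egf : (expY ⊖ one) ≈egf expm1Y
expm1Y-egf zero    zero    = refl
expm1Y-egf zero    (suc j) = trans (ℚP.+-identityʳ (invFact (suc j)))
  (unit-fraction (suc j !) (1 * suc j !) {{suc j !≢0}} {{0 !* suc j !≢0}} (sym (*-identityˡ _)))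
expm1Y-egf (suc i) zero    = zero-fraction (suc i ! * 1) {{suc i !* 0 !≢0}}
expm1Y-egf (suc i) (suc j) = zero-fraction (suc i ! * suc j !) {{suc i !* suc j !≢0}}

varX-egf : X ≈egf varX
varX-egf zero             j       = zero-fraction (1 * j !) {{0 !* j !≢0}}
varX-egf (suc zero)       zero    = refl
varX-egf (suc zero)       (suc j) = zero-fraction (1 * suc j !) {{1 !* suc j !≢0}}
varX-egf (suc (suc i))    j       = zero-fraction (suc (suc i) ! * j !) {{suc (suc i) !* j !≢0}}

varY-egf : Y ≈egf varY
varY-egf zero    zero          = refl
varY-egf zero    (suc zero)    = refl
varY-egf zero    (suc (suc j)) = zero-fraction (1 * suc (suc j) !) {{0 !* suc (suc j) !≢0}}
varY-egf (suc i) j             = zero-fraction (suc i ! * j !) {{suc i !* j !≢0}}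

splitSum-at-zeroˡ : ∀ n (u v : ℕ → ℕ) → (∀ j → u (suc j) ≡ 0) → splitSum n (λ j l → u j * v l) ≡ u 0 * v n
splitSum-at-zeroˡ zero    u v u-vanishes = refl
splitSum-at-zeroˡ (suc n) u v u-vanishes = cong₂ _+_
  (trans (splitSum-cong n (λ j l → cong (_* v l) (u-vanishes j))) (splitSum-zero n))
  (splitSum-at-zeroˡ n u (λ l → v (suc l)) u-vanishes)

splitSum-at-zeroʳ : ∀ m (u w : ℕ → ℕ) → (∀ k → w (suc k) ≡ 0) → splitSum m (λ i k → u i * w k) ≡ u m * w 0
splitSum-at-zeroʳ zero    u w w-vanishes = refl
splitSum-at-zeroʳ (suc m) u w w-vanishes = trans (cong₂ _+_
  (splitSum-at-zeroʳ m (λ i → u (suc i)) w w-vanishes)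
  (trans (splitSum-cong m (λ i k → trans (cong (u i *_) (w-vanishes k)) (*-zeroʳ (u i)))) (splitSum-zero m)))
  (+-identityʳ _)

⋆-separated : ∀ a b → (∀ i j → a i (suc j) ≡ 0) → (∀ i j → b (suc i) j ≡ 0) →
  ∀ m n → (a ⋆ b) m n ≡ a m 0 * b 0 n
⋆-separated a b a-in-x b-in-y m n =
  trans (splitSum-cong m (λ i k → splitSum-at-zeroˡ n (a i) (b k) (a-in-x i)))
        (splitSum-at-zeroʳ m (λ i → a i 0) (λ k → b k n) (λ k → b-in-y k n))

conn-decomposition : ∀ m n → expm1X m 0 * expm1Y 0 n + varX m n + varY m n ≡ conn m n
conn-decomposition zero          zero          = refl
conn-decomposition zero          (suc zero)    = refl
conn-decomposition zero          (suc (suc n)) = refl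
conn-decomposition (suc zero)    zero          = refl
conn-decomposition (suc (suc m)) zero          = refl
conn-decomposition (suc zero)    (suc n)       = refl
conn-decomposition (suc (suc m)) (suc n)       = refl

F-egf : F ≈egf conn
F-egf m n = begin
  ((expX ⊖ one) ⊗ (expY ⊖ one)) m n +q X m n +q Y m n
    ≡⟨ cong₂ _+q_ (cong₂ _+q_ (egf-⊗ expm1X expm1Y expm1X-egf expm1Y-egf m n) (varX-egf m n)) (varY-egf m n) ⟩
  egf (expm1X ⋆ expm1Y) m n +q egf varX m n +q egf varY m n
    ≡⟨ cong (_+q egf varY m n) (egf-+ (expm1X ⋆ expm1Y) varX m n) ⟩
  egf (λ m n → (expm1X ⋆ expm1Y) m n + varX m n) m n +q egf varY m n
    ≡⟨ egf-+ (λ m n → (expm1X ⋆ expm1Y) m n + varX m n) varY m n ⟩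
  egf (λ m n → (expm1X ⋆ expm1Y) m n + varX m n + varY m n) m n
    ≡⟨ cong (λ t → (+ t / (m ! * n !)) {{m !* n !≢0}})
            (trans (cong (λ t → t + varX m n + varY m n) (⋆-separated expm1X expm1Y x-only y-only m n))
                   (conn-decomposition m n)) ⟩
  egf conn m n ∎
  where
  open ≡-Reasoning
  x-only : ∀ i j → expm1X i (suc j) ≡ 0
  x-only zero    j = refl
  x-only (suc i) j = refl
  y-only : ∀ i j → expm1Y (suc i) j ≡ 0
  y-only i j = refl

pow-F-egf : ∀ k → pow F k ≈egf pow⋆ conn k
pow-F-egf zero    zero    zero    = refl
pow-F-egf zero    zero    (suc n) = zero-fraction (1 * suc n !) {{0 !* suc n !≢0}}
pow-F-egf zero    (suc m) n       = zero-fraction (suc m ! * n !) {{suc m !* n !≢0}}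
pow-F-egf (suc k) m       n       = egf-⊗ conn (pow⋆ conn k) F-egf (pow-F-egf k) m n

-- exp(F) = Σ_k Fᵏ/k! has coefficients count m n / (m! n!), since
-- Fᵏ/k! has coefficients blocks k m n / (m! n!).
expS-F-egf : expS F ≈egf count
expS-F-egf m n = begin
  sumTo (m + n) (λ k → pow F k m n *q invFact k)
    ≡⟨ sumTo-cong-on (m + n) (λ k _ → trans (cong (_*q invFact k) (pow-F-egf k m n)) (power-over-factorial k)) ⟩
  sumTo (m + n) (λ k → + blocks k m n / d)
    ≡⟨ sumTo-fraction (m + n) (λ k → blocks k m n) d ⟩
  egf count m n ∎
  where
  open ≡-Reasoning
  d : ℕ
  d = m ! * n !
  instance
    d≢0 : NonZero d
    d≢0 = m !* n !≢0
  power-over-factorial : ∀ k → egf (pow⋆ conn k) m n *q invFact k ≡ + blocks k m n / d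
  power-over-factorial k = fraction-* (pow⋆ conn k m n) 1 (blocks k m n) d (k !) d {{d≢0}} {{k !≢0}}
    (trans (cong (λ t → (t * 1) * d) (pow-conn k m n)) (rearrange (blocks k m n) (k !) d))
    where
    rearrange : ∀ P K D → (K * P * 1) * D ≡ P * (D * K)
    rearrange = solve-∀

map-unique : ∀ {A B : Set} (g : A → B) (xs : List A) → Unique xs →
  (∀ x y → x ∈ xs → y ∈ xs → g x ≡ g y → x ≡ y) → Unique (map g xs)
map-unique g []       _         _     = []
map-unique g (x ∷ xs) (x∉ ∷ xs!) g-inj =
  All.tabulate (λ {y′} y′∈ gx≡y′ → let (y , y∈xs , y′≡gy) = ∈-map⁻ g y′∈ in
                 All.lookup x∉ y∈xs (g-inj x y (here refl) (there y∈xs) (trans gx≡y′ y′≡gy)))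
  ∷ map-unique g xs xs! (λ a b a∈ b∈ → g-inj a b (there a∈) (there b∈))

module Matrices {size : ℕ} where

  matrixOf : (P : Fin size → Fin size → Set) → (∀ i j → Dec (P i j)) → Rel size
  matrixOf P P? = tabulate (λ i → tabulate (λ j → ⌊ P? i j ⌋))

  matrixOf-entry : ∀ P P? i j → lookup (lookup (matrixOf P P?) i) j ≡ ⌊ P? i j ⌋
  matrixOf-entry P P? i j =
    trans (cong (λ row → lookup row j) (lookup∘tabulate (λ i → tabulate (λ j → ⌊ P? i j ⌋)) i))
          (lookup∘tabulate (λ j → ⌊ P? i j ⌋) j)

  ∼-matrixOf⁻ : ∀ {P} (P? : ∀ i j → Dec (P i j)) {i j} → i ∼[ matrixOf P P? ] j → P i j
  ∼-matrixOf⁻ {P} P? {i} {j} i∼j = toWitness (subst T (matrixOf-entry P P? i j) i∼j)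

  ∼-matrixOf⁺ : ∀ {P} (P? : ∀ i j → Dec (P i j)) {i j} → P i j → i ∼[ matrixOf P P? ] j
  ∼-matrixOf⁺ {P} P? {i} {j} p = subst T (sym (matrixOf-entry P P? i j)) (fromWitness p)

  T-ext : ∀ {a b : Bool} → (T a → T b) → (T b → T a) → a ≡ b
  T-ext {true}  {true}  _ _ = refl
  T-ext {true}  {false} a⇒b _ = ⊥-elim (a⇒b tt)
  T-ext {false} {true}  _ b⇒a = ⊥-elim (b⇒a tt)
  T-ext {false} {false} _ _ = refl

  vec-ext : ∀ {A : Set} {k} (u v : Vec A k) → (∀ i → lookup u i ≡ lookup v i) → u ≡ v
  vec-ext u v u≗v = trans (sym (tabulate∘lookup u)) (trans (tabulate-cong u≗v) (tabulate∘lookup v))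

  matrix-ext : ∀ (r s : Rel size) → (∀ i j → i ∼[ r ] j → i ∼[ s ] j) → (∀ i j → i ∼[ s ] j → i ∼[ r ] j) → r ≡ s
  matrix-ext r s r⊆s s⊆r =
    vec-ext r s (λ i → vec-ext (lookup r i) (lookup s i) (λ j → T-ext (r⊆s i j) (s⊆r i j)))

-- The vertices
-- Fin size are coloured by side; a partition is good if each of its blocks
-- is a single vertex or meets both sides.  For the complete bipartite
-- graph between the two colour classes these are exactly the compositions.
module Enumeration {size : ℕ} (side : Fin size → Bool) where
  open Matrices {size}
  open import Data.List.Membership.DecPropositional (_≟ᶠ_ {size}) using (_∈?_)

  V : Set
  V = Fin size

  -- The numbers of x-side (side true) and of y-side vertices in a list.
  #x #y : List V → ℕ
  #x []       = 0
  #x (v ∷ vs) = if side v then suc (#x vs) else #x vs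
  #y []       = 0
  #y (v ∷ vs) = if side v then #y vs else suc (#y vs)

  #-∷-x : ∀ {v} vs → side v ≡ true → #x (v ∷ vs) ≡ suc (#x vs) × #y (v ∷ vs) ≡ #y vs
  #-∷-x {v} vs x-side rewrite x-side = refl , refl

  #-∷-y : ∀ {v} vs → side v ≡ false → #x (v ∷ vs) ≡ #x vs × #y (v ∷ vs) ≡ suc (#y vs)
  #-∷-y {v} vs y-side rewrite y-side = refl , refl

  #x+#y : ∀ vs → #x vs + #y vs ≡ length vs
  #x+#y []       = refl
  #x+#y (v ∷ vs) with side v
  ... | true  = cong suc (#x+#y vs)
  ... | false = trans (+-suc (#x vs) (#y vs)) (cong suc (#x+#y vs))

  ∈⇒#x-pos : ∀ {v} vs → v ∈ vs → side v ≡ true → Σ ℕ λ a → #x vs ≡ suc a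
  ∈⇒#x-pos (v ∷ vs) (here refl) x-side = #x vs , proj₁ (#-∷-x vs x-side)
  ∈⇒#x-pos (u ∷ vs) (there v∈)  x-side with side u | ∈⇒#x-pos vs v∈ x-side
  ... | true  | _ = #x vs , refl
  ... | false | a , #x≡1+a = a , #x≡1+a

  ∈⇒#y-pos : ∀ {v} vs → v ∈ vs → side v ≡ false → Σ ℕ λ a → #y vs ≡ suc a
  ∈⇒#y-pos (v ∷ vs) (here refl) y-side = #y vs , proj₂ (#-∷-y vs y-side)
  ∈⇒#y-pos (u ∷ vs) (there v∈)  y-side with side u | ∈⇒#y-pos vs v∈ y-side
  ... | true  | a , #y≡1+a = a , #y≡1+a
  ... | false | _ = #y vs , refl

  #x-pos⇒∈ : ∀ vs a → #x vs ≡ suc a → Σ V λ v → v ∈ vs × side v ≡ true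
  #x-pos⇒∈ (u ∷ vs) a #x≡1+a with side u in u-side
  ... | true  = u , here refl , u-side
  ... | false = let (v , v∈ , v-side) = #x-pos⇒∈ vs a #x≡1+a in v , there v∈ , v-side

  #y-pos⇒∈ : ∀ vs a → #y vs ≡ suc a → Σ V λ v → v ∈ vs × side v ≡ false
  #y-pos⇒∈ (u ∷ vs) a #y≡1+a with side u in u-side
  ... | true  = let (v , v∈ , v-side) = #y-pos⇒∈ vs a #y≡1+a in v , there v∈ , v-side
  ... | false = u , here refl , u-side

  connectedBlock : List V → Bool
  connectedBlock B = connectedK (#x B) (#y B)

  singleton-member : ∀ {y z : V} (vs : List V) → length vs ≡ 1 → y ∈ vs → z ∈ vs → y ≡ z
  singleton-member (v ∷ []) _ (here refl) (here refl) = refl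

  opposite-in-block : ∀ B {y z} → T (connectedBlock B) → y ∈ B → z ∈ B → y ≢ z →
    Σ V λ w → w ∈ B × side w ≢ side y
  opposite-in-block B {y} {z} connected y∈B z∈B y≢z with connectedK-cases (#x B) (#y B) connected
  ... | inj₁ single = ⊥-elim (y≢z (singleton-member B (trans (sym (#x+#y B)) single) y∈B z∈B))
  ... | inj₂ (a , b , #x≡1+a , #y≡1+b) with side y in y-side
  ...   | true  = let (w , w∈B , w-side) = #y-pos⇒∈ B b #y≡1+b in w , w∈B , (λ eq → true≢false (trans (sym eq) w-side))
  ...   | false = let (w , w∈B , w-side) = #x-pos⇒∈ B a #x≡1+a in w , w∈B , (λ eq → true≢false (trans (sym w-side) eq))

  both-sides⇒connected : ∀ B {y z} → y ∈ B → z ∈ B → side z ≢ side y → T (connectedBlock B)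
  both-sides⇒connected B {y} {z} y∈B z∈B sides≢ with side y in y-side | side z in z-side
  ... | true  | true  = ⊥-elim (sides≢ refl)
  ... | false | false = ⊥-elim (sides≢ refl)
  ... | true  | false = let (a , #x≡1+a) = ∈⇒#x-pos B y∈B y-side ; (b , #y≡1+b) = ∈⇒#y-pos B z∈B z-side in
                        subst₂ (λ s t → T (connectedK s t)) (sym #x≡1+a) (sym #y≡1+b) tt
  ... | false | true  = let (a , #x≡1+a) = ∈⇒#x-pos B z∈B z-side ; (b , #y≡1+b) = ∈⇒#y-pos B y∈B y-side in
                        subst₂ (λ s t → T (connectedK s t)) (sym #x≡1+a) (sym #y≡1+b) tt

  connectedBlock-intro : ∀ B {v} → Unique B → v ∈ B →
    (∀ y z → y ∈ B → z ∈ B → y ≢ z → Σ V λ w → w ∈ B × side w ≢ side y) → T (connectedBlock B)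
  connectedBlock-intro (u ∷ [])     _               _ _        = connectedK-single (#x (u ∷ [])) (#y (u ∷ [])) (#x+#y (u ∷ []))
  connectedBlock-intro (u ∷ w ∷ vs) ((u≢w All.∷ _) ∷ _) _ partner =
    let (z , z∈ , sides≢) = partner u w (here refl) (there (here refl)) u≢w in
    both-sides⇒connected (u ∷ w ∷ vs) (here refl) z∈ sides≢

  record GoodPartition (P : V → Set) (r : Rel size) : Set where
    field
      support    : ∀ i j → i ∼[ r ] j → P i
      reflexive  : ∀ i → P i → i ∼[ r ] i
      symmetric  : ∀ i j → i ∼[ r ] j → j ∼[ r ] i
      transitive : ∀ i j k → i ∼[ r ] j → j ∼[ r ] k → i ∼[ r ] k
      mixed      : ∀ u w → u ∼[ r ] w → u ≢ w → Σ V λ z → u ∼[ r ] z × side z ≢ side u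

  GoodPartition-resp : ∀ {P P′ : V → Set} {r} → (∀ x → P x → P′ x) → (∀ x → P′ x → P x) →
    GoodPartition P r → GoodPartition P′ r
  GoodPartition-resp P⇒P′ P′⇒P good = record
    { support = λ i j i∼j → P⇒P′ i (support i j i∼j) ; reflexive = λ i p → reflexive i (P′⇒P i p)
    ; symmetric = symmetric ; transitive = transitive ; mixed = mixed }
    where open GoodPartition good

  emptyPartition : Rel size
  emptyPartition = matrixOf (λ _ _ → ⊥) (λ _ _ → no (λ ()))

  addBlock? : (B : List V) (r : Rel size) → ∀ i j → Dec ((i ∈ B × j ∈ B) ⊎ i ∼[ r ] j)
  addBlock? B r i j = (i ∈? B ×-dec j ∈? B) ⊎-dec T? _

  addBlock : List V → Rel size → Rel size
  addBlock B r = matrixOf _ (addBlock? B r)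

  removeBlock? : (r : Rel size) (v : V) → ∀ i j → Dec (i ∼[ r ] j × ¬ v ∼[ r ] i)
  removeBlock? r v i j = T? _ ×-dec ¬? (T? _)

  removeBlock : Rel size → V → Rel size
  removeBlock r v = matrixOf _ (removeBlock? r v)

  ∼-addBlock⁻ : ∀ {B r i j} → i ∼[ addBlock B r ] j → (i ∈ B × j ∈ B) ⊎ i ∼[ r ] j
  ∼-addBlock⁻ {B} {r} = ∼-matrixOf⁻ (addBlock? B r)

  ∼-addBlock⁺ : ∀ {B r i j} → (i ∈ B × j ∈ B) ⊎ i ∼[ r ] j → i ∼[ addBlock B r ] j
  ∼-addBlock⁺ {B} {r} = ∼-matrixOf⁺ (addBlock? B r)

  ∼-removeBlock⁻ : ∀ {r v i j} → i ∼[ removeBlock r v ] j → i ∼[ r ] j × ¬ v ∼[ r ] i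
  ∼-removeBlock⁻ {r} {v} = ∼-matrixOf⁻ (removeBlock? r v)

  ∼-removeBlock⁺ : ∀ {r v i j} → i ∼[ r ] j → ¬ v ∼[ r ] i → i ∼[ removeBlock r v ] j
  ∼-removeBlock⁺ {r} {v} i∼j v≁i = ∼-matrixOf⁺ (removeBlock? r v) (i∼j , v≁i)

  mutual
    -- partitions t S lists the good partitions of the vertices of S (without
    -- repetitions, when S has none); t is fuel, sufficient if length S ≤ t.
    -- The block of the head of S is chosen first.
    partitions : ℕ → List V → List (Rel size)
    partitions t       []      = emptyPartition ∷ []
    partitions zero    (v ∷ S) = []
    partitions (suc t) (v ∷ S) = withBlock t (v ∷ []) [] S

    -- withBlock t B R S lists the good partitions of B ++ R ++ S having B
    -- inside one block and R outside it, deciding for each vertex of S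
    -- whether it joins that block.
    withBlock : ℕ → List V → List V → List V → List (Rel size)
    withBlock t B R []      = if connectedBlock B then map (addBlock B) (partitions t R) else []
    withBlock t B R (x ∷ S) = withBlock t (x ∷ B) R S ++ withBlock t B (x ∷ R) S

  fuel-block : ∀ {t} (R S : List V) x → length R + length (x ∷ S) ≤ t → length R + length S ≤ t
  fuel-block R S x fuel = ≤-trans (+-monoʳ-≤ (length R) (n≤1+n _)) fuel

  fuel-rest : ∀ {t} (R S : List V) x → length R + length (x ∷ S) ≤ t → length (x ∷ R) + length S ≤ t
  fuel-rest {t} R S x fuel = subst (_≤ t) (+-suc (length R) (length S)) fuel

  -- The number of partitions listed by withBlock, in terms of the side
  -- counts of the block, the rest and the undecided vertices.
  extensionCount : (bx by rx ry sx sy : ℕ) → ℕ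
  extensionCount bx by rx ry sx sy = splitSum₂ sx sy (λ i j k l → conn (bx + i) (by + j) * count (rx + k) (ry + l))

  extensions : List V → List V → List V → ℕ
  extensions B R S = extensionCount (#x B) (#y B) (#x R) (#y R) (#x S) (#y S)

  extensionCount-sucˣ : ∀ bx by rx ry sx sy → extensionCount bx by rx ry (suc sx) sy ≡
    extensionCount (suc bx) by rx ry sx sy + extensionCount bx by (suc rx) ry sx sy
  extensionCount-sucˣ bx by rx ry sx sy = cong₂ _+_
    (splitSum₂-cong sx sy (λ i j k l → cong (λ b → conn b (by + j) * count (rx + k) (ry + l)) (+-suc bx i)))
    (splitSum₂-cong sx sy (λ i j k l → cong (λ r → conn (bx + i) (by + j) * count r (ry + l)) (+-suc rx k)))

  extensionCount-sucʸ : ∀ bx by rx ry sx sy → extensionCount bx by rx ry sx (suc sy) ≡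
    extensionCount bx (suc by) rx ry sx sy + extensionCount bx by rx (suc ry) sx sy
  extensionCount-sucʸ bx by rx ry sx sy =
    trans (splitSum₂-sucʸ sx sy (λ i j k l → conn (bx + i) (by + j) * count (rx + k) (ry + l))) (cong₂ _+_
      (splitSum₂-cong sx sy (λ i j k l → cong (λ b → conn (bx + i) b * count (rx + k) (ry + l)) (+-suc by j)))
      (splitSum₂-cong sx sy (λ i j k l → cong (λ r → conn (bx + i) (by + j) * count (rx + k) r) (+-suc ry l))))

  extensionCount-zero : ∀ bx by rx ry → extensionCount bx by rx ry 0 0 ≡ conn bx by * count rx ry
  extensionCount-zero bx by rx ry =
    cong₂ _*_ (cong₂ conn (+-identityʳ bx) (+-identityʳ by)) (cong₂ count (+-identityʳ rx) (+-identityʳ ry))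

  extensions-∷ : ∀ B R S x → extensions (x ∷ B) R S + extensions B (x ∷ R) S ≡ extensions B R (x ∷ S)
  extensions-∷ B R S x with side x
  ... | true  = sym (extensionCount-sucˣ (#x B) (#y B) (#x R) (#y R) (#x S) (#y S))
  ... | false = sym (extensionCount-sucʸ (#x B) (#y B) (#x R) (#y R) (#x S) (#y S))

  length-if : ∀ (b : Bool) (xs : List (Rel size)) → length (if b then xs else []) ≡ (if b then 1 else 0) * length xs
  length-if true  xs = sym (+-identityʳ _)
  length-if false xs = refl

  length-withBlock : ∀ t B R S → length R + length S ≤ t →
    (∀ R′ → length R′ ≤ t → length (partitions t R′) ≡ count (#x R′) (#y R′)) →
    length (withBlock t B R S) ≡ extensions B R S
  length-withBlock t B R [] fuel length-partitions = begin
    length (if connectedBlock B then map (addBlock B) (partitions t R) else [])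
      ≡⟨ length-if (connectedBlock B) (map (addBlock B) (partitions t R)) ⟩
    conn (#x B) (#y B) * length (map (addBlock B) (partitions t R))
      ≡⟨ cong (conn (#x B) (#y B) *_) (length-map (addBlock B) (partitions t R)) ⟩
    conn (#x B) (#y B) * length (partitions t R)
      ≡⟨ cong (conn (#x B) (#y B) *_) (length-partitions R (subst (_≤ t) (+-identityʳ _) fuel)) ⟩
    conn (#x B) (#y B) * count (#x R) (#y R)
      ≡⟨ extensionCount-zero (#x B) (#y B) (#x R) (#y R) ⟨
    extensions B R [] ∎
    where open ≡-Reasoning
  length-withBlock t B R (x ∷ S) fuel length-partitions = begin
    length (withBlock t (x ∷ B) R S ++ withBlock t B (x ∷ R) S)
      ≡⟨ length-++ (withBlock t (x ∷ B) R S) ⟩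
    length (withBlock t (x ∷ B) R S) + length (withBlock t B (x ∷ R) S)
      ≡⟨ cong₂ _+_ (length-withBlock t (x ∷ B) R S (fuel-block R S x fuel) length-partitions)
                   (length-withBlock t B (x ∷ R) S (fuel-rest R S x fuel) length-partitions) ⟩
    extensions (x ∷ B) R S + extensions B (x ∷ R) S
      ≡⟨ extensions-∷ B R S x ⟩
    extensions B R (x ∷ S) ∎
    where open ≡-Reasoning

  -- Choosing the block of the first vertex is the recursion defining count.
  first-block : ∀ v S → extensions (v ∷ []) [] S ≡ count (#x (v ∷ S)) (#y (v ∷ S))
  first-block v S with side v
  ... | true  = sym (count-sucˣ (#x S) (#y S))
  ... | false = sym (count-sucʸ (#x S) (#y S))

  length-partitions : ∀ t S → length S ≤ t → length (partitions t S) ≡ count (#x S) (#y S)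
  length-partitions t       []      _          = refl
  length-partitions (suc t) (v ∷ S) (s≤s fuel) =
    trans (length-withBlock t (v ∷ []) [] S fuel (length-partitions t)) (first-block v S)

  head∉tail : ∀ {x : V} {S} → Unique (x ∷ S) → ¬ x ∈ S
  head∉tail (x∉S ∷ _) x∈S = All.lookup x∉S x∈S refl

  ∷-unique : ∀ {x : V} {R} → ¬ x ∈ R → Unique R → Unique (x ∷ R)
  ∷-unique {x} {R} x∉R R! = All.tabulate (λ {y} y∈R x≡y → x∉R (subst (_∈ R) (sym x≡y) y∈R)) ∷ R!

  tail-unique : ∀ {x : V} {S} → Unique (x ∷ S) → Unique S
  tail-unique (_ ∷ S!) = S!

  -- The invariant of withBlock t B R S: the three lists are duplicate-free
  -- and pairwise disjoint.
  record Separated (B R S : List V) : Set where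
    field
      B! : Unique B
      R! : Unique R
      S! : Unique S
      B#R : Disjoint B R
      B#S : Disjoint B S
      R#S : Disjoint R S

  separated-start : ∀ {v S} → Unique (v ∷ S) → Separated (v ∷ []) [] S
  separated-start vS! = record
    { B! = All.[] ∷ [] ; R! = [] ; S! = tail-unique vS!
    ; B#R = λ { (_ , ()) } ; B#S = λ { (here refl , v∈S) → head∉tail vS! v∈S } ; R#S = λ { (() , _) } }

  separated-block : ∀ {x B R S} → Separated B R (x ∷ S) → Separated (x ∷ B) R S
  separated-block {x} {B} {R} {S} sep = record
    { B! = ∷-unique (λ x∈B → B#S (x∈B , here refl)) B! ; R! = R! ; S! = tail-unique S!
    ; B#R = λ { (here refl , x∈R) → R#S (x∈R , here refl) ; (there y∈B , y∈R) → B#R (y∈B , y∈R) }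
    ; B#S = λ { (here refl , x∈S) → head∉tail S! x∈S ; (there y∈B , y∈S) → B#S (y∈B , there y∈S) }
    ; R#S = λ { (y∈R , y∈S) → R#S (y∈R , there y∈S) } }
    where open Separated sep

  separated-rest : ∀ {x B R S} → Separated B R (x ∷ S) → Separated B (x ∷ R) S
  separated-rest {x} {B} {R} {S} sep = record
    { B! = B! ; R! = ∷-unique (λ x∈R → R#S (x∈R , here refl)) R! ; S! = tail-unique S!
    ; B#R = λ { (x∈B , here refl) → B#S (x∈B , here refl) ; (y∈B , there y∈R) → B#R (y∈B , y∈R) }
    ; B#S = λ { (y∈B , y∈S) → B#S (y∈B , there y∈S) }
    ; R#S = λ { (here refl , x∈S) → head∉tail S! x∈S ; (there y∈R , y∈S) → R#S (y∈R , there y∈S) } }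
    where open Separated sep

  In : List V → List V → List V → V → Set
  In B R S y = y ∈ B ⊎ y ∈ R ⊎ y ∈ S

  In-block⁺ : ∀ {x B R S} y → In (x ∷ B) R S y → In B R (x ∷ S) y
  In-block⁺ y (inj₁ (here e))        = inj₂ (inj₂ (here e))
  In-block⁺ y (inj₁ (there y∈B))     = inj₁ y∈B
  In-block⁺ y (inj₂ (inj₁ y∈R))      = inj₂ (inj₁ y∈R)
  In-block⁺ y (inj₂ (inj₂ y∈S))      = inj₂ (inj₂ (there y∈S))

  In-block⁻ : ∀ {x B R S} y → In B R (x ∷ S) y → In (x ∷ B) R S y
  In-block⁻ y (inj₁ y∈B)                 = inj₁ (there y∈B)
  In-block⁻ y (inj₂ (inj₁ y∈R))          = inj₂ (inj₁ y∈R)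
  In-block⁻ y (inj₂ (inj₂ (here e)))     = inj₁ (here e)
  In-block⁻ y (inj₂ (inj₂ (there y∈S)))  = inj₂ (inj₂ y∈S)

  In-rest⁺ : ∀ {x B R S} y → In B (x ∷ R) S y → In B R (x ∷ S) y
  In-rest⁺ y (inj₁ y∈B)                 = inj₁ y∈B
  In-rest⁺ y (inj₂ (inj₁ (here e)))     = inj₂ (inj₂ (here e))
  In-rest⁺ y (inj₂ (inj₁ (there y∈R)))  = inj₂ (inj₁ y∈R)
  In-rest⁺ y (inj₂ (inj₂ y∈S))          = inj₂ (inj₂ (there y∈S))

  In-rest⁻ : ∀ {x B R S} y → In B R (x ∷ S) y → In B (x ∷ R) S y
  In-rest⁻ y (inj₁ y∈B)                 = inj₁ y∈B
  In-rest⁻ y (inj₂ (inj₁ y∈R))          = inj₂ (inj₁ (there y∈R))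
  In-rest⁻ y (inj₂ (inj₂ (here e)))     = inj₂ (inj₁ (here e))
  In-rest⁻ y (inj₂ (inj₂ (there y∈S)))  = inj₂ (inj₂ y∈S)

  In-start⁺ : ∀ {v S} y → In (v ∷ []) [] S y → y ∈ v ∷ S
  In-start⁺ y (inj₁ (here e))    = here e
  In-start⁺ y (inj₂ (inj₂ y∈S))  = there y∈S

  In-start⁻ : ∀ {v S} y → y ∈ v ∷ S → In (v ∷ []) [] S y
  In-start⁻ y (here e)    = inj₁ (here e)
  In-start⁻ y (there y∈S) = inj₂ (inj₂ y∈S)

  emptyPartition-good : GoodPartition (_∈ []) emptyPartition
  emptyPartition-good = record
    { support = λ i j i∼j → ⊥-elim (empty i∼j) ; reflexive = λ i ()
    ; symmetric = λ i j i∼j → ⊥-elim (empty i∼j) ; transitive = λ i j k i∼j _ → ⊥-elim (empty i∼j)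
    ; mixed = λ u w u∼w _ → ⊥-elim (empty u∼w) }
    where
    empty : ∀ {i j} → ¬ i ∼[ emptyPartition ] j
    empty = ∼-matrixOf⁻ (λ _ _ → no (λ ()))

  addBlock-good : ∀ B R r → T (connectedBlock B) → Disjoint B R → GoodPartition (_∈ R) r →
    GoodPartition (λ x → x ∈ B ⊎ x ∈ R) (addBlock B r)
  addBlock-good B R r connected B#R good = record
    { support = support′ ; reflexive = reflexive′ ; symmetric = symmetric′
    ; transitive = transitive′ ; mixed = mixed′ }
    where
    open GoodPartition good
    support′ : ∀ i j → i ∼[ addBlock B r ] j → i ∈ B ⊎ i ∈ R
    support′ i j i∼j with ∼-addBlock⁻ {B} {r} i∼j
    ... | inj₁ (i∈B , _) = inj₁ i∈B
    ... | inj₂ i∼j′      = inj₂ (support i j i∼j′)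
    reflexive′ : ∀ i → i ∈ B ⊎ i ∈ R → i ∼[ addBlock B r ] i
    reflexive′ i (inj₁ i∈B) = ∼-addBlock⁺ {B} {r} (inj₁ (i∈B , i∈B))
    reflexive′ i (inj₂ i∈R) = ∼-addBlock⁺ {B} {r} (inj₂ (reflexive i i∈R))
    symmetric′ : ∀ i j → i ∼[ addBlock B r ] j → j ∼[ addBlock B r ] i
    symmetric′ i j i∼j with ∼-addBlock⁻ {B} {r} i∼j
    ... | inj₁ (i∈B , j∈B) = ∼-addBlock⁺ {B} {r} (inj₁ (j∈B , i∈B))
    ... | inj₂ i∼j′        = ∼-addBlock⁺ {B} {r} (inj₂ (symmetric i j i∼j′))
    transitive′ : ∀ i j k → i ∼[ addBlock B r ] j → j ∼[ addBlock B r ] k → i ∼[ addBlock B r ] k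
    transitive′ i j k i∼j j∼k with ∼-addBlock⁻ {B} {r} i∼j | ∼-addBlock⁻ {B} {r} j∼k
    ... | inj₁ (i∈B , _)   | inj₁ (_ , k∈B) = ∼-addBlock⁺ {B} {r} (inj₁ (i∈B , k∈B))
    ... | inj₁ (_ , j∈B)   | inj₂ j∼k′      = ⊥-elim (B#R (j∈B , support j k j∼k′))
    ... | inj₂ i∼j′        | inj₁ (j∈B , _) = ⊥-elim (B#R (j∈B , support j i (symmetric i j i∼j′)))
    ... | inj₂ i∼j′        | inj₂ j∼k′      = ∼-addBlock⁺ {B} {r} (inj₂ (transitive i j k i∼j′ j∼k′))
    mixed′ : ∀ u w → u ∼[ addBlock B r ] w → u ≢ w → Σ V λ z → u ∼[ addBlock B r ] z × side z ≢ side u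
    mixed′ u w u∼w u≢w with ∼-addBlock⁻ {B} {r} u∼w
    ... | inj₁ (u∈B , w∈B) = let (z , z∈B , sides≢) = opposite-in-block B connected u∈B w∈B u≢w in
                             z , ∼-addBlock⁺ {B} {r} (inj₁ (u∈B , z∈B)) , sides≢
    ... | inj₂ u∼w′        = let (z , u∼z , sides≢) = mixed u w u∼w′ u≢w in
                             z , ∼-addBlock⁺ {B} {r} (inj₂ u∼z) , sides≢

  withBlock-sound : ∀ t B R S {r} → (∀ R′ {r′} → Unique R′ → r′ ∈ partitions t R′ → GoodPartition (_∈ R′) r′) →
    Separated B R S → r ∈ withBlock t B R S → GoodPartition (In B R S) r
  withBlock-sound t B R [] partitions-sound sep r∈ with connectedBlock B in connected
  ... | true = let (r′ , r′∈ , r≡) = ∈-map⁻ (addBlock B) r∈ in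
    subst (GoodPartition (In B R [])) (sym r≡)
      (GoodPartition-resp (λ { y (inj₁ y∈B) → inj₁ y∈B ; y (inj₂ y∈R) → inj₂ (inj₁ y∈R) })
                          (λ { y (inj₁ y∈B) → inj₁ y∈B ; y (inj₂ (inj₁ y∈R)) → inj₂ y∈R })
        (addBlock-good B R r′ (subst T (sym connected) tt) (Separated.B#R sep)
                       (partitions-sound R (Separated.R! sep) r′∈)))
  withBlock-sound t B R (x ∷ S) partitions-sound sep r∈ with ∈-++⁻ (withBlock t (x ∷ B) R S) r∈
  ... | inj₁ r∈ˡ = GoodPartition-resp In-block⁺ In-block⁻
                     (withBlock-sound t (x ∷ B) R S partitions-sound (separated-block sep) r∈ˡ)
  ... | inj₂ r∈ʳ = GoodPartition-resp In-rest⁺ In-rest⁻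
                     (withBlock-sound t B (x ∷ R) S partitions-sound (separated-rest sep) r∈ʳ)

  partitions-sound : ∀ t S {r} → Unique S → r ∈ partitions t S → GoodPartition (_∈ S) r
  partitions-sound t       []      _   (here refl) = emptyPartition-good
  partitions-sound (suc t) (v ∷ S) vS! r∈          = GoodPartition-resp In-start⁺ In-start⁻
    (withBlock-sound t (v ∷ []) [] S (λ R′ R′! → partitions-sound t R′ R′!) (separated-start vS!) r∈)

  ∈-if-true : ∀ {b} {xs : List (Rel size)} {r} → T b → r ∈ xs → r ∈ (if b then xs else [])
  ∈-if-true {true} _ r∈ = r∈

  -- Completeness: a good partition r of W, followed along the choices
  -- "joins the block of v or not", is listed.
  module Completeness {W : List V} {r : Rel size} (good : GoodPartition (_∈ W) r) (v : V) where
    open GoodPartition good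

    block-connected : ∀ B → Unique B → v ∈ B → (∀ x → x ∈ B → v ∼[ r ] x) → (∀ x → v ∼[ r ] x → x ∈ B) →
      T (connectedBlock B)
    block-connected B B! v∈B B⊆v v⊆B = connectedBlock-intro B B! v∈B (λ y z y∈B z∈B y≢z →
      let (w , y∼w , sides≢) = mixed y z (transitive y v z (symmetric v y (B⊆v y y∈B)) (B⊆v z z∈B)) y≢z in
      w , v⊆B w (transitive v y w (B⊆v y y∈B) y∼w) , sides≢)

    removeBlock-good : ∀ R → (∀ i → i ∈ R → i ∈ W × ¬ v ∼[ r ] i) → (∀ i → i ∈ W → ¬ v ∼[ r ] i → i ∈ R) →
      GoodPartition (_∈ R) (removeBlock r v)
    removeBlock-good R R⊆ rest⊆R = record
      { support    = λ i j i∼j → let (i∼ʳj , v≁i) = ∼-removeBlock⁻ {r} {v} i∼j in rest⊆R i (support i j i∼ʳj) v≁i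
      ; reflexive  = λ i i∈R → let (i∈W , v≁i) = R⊆ i i∈R in ∼-removeBlock⁺ {r} {v} (reflexive i i∈W) v≁i
      ; symmetric  = λ i j i∼j → let (i∼ʳj , v≁i) = ∼-removeBlock⁻ {r} {v} i∼j in
                       ∼-removeBlock⁺ {r} {v} (symmetric i j i∼ʳj) (λ v∼j → v≁i (transitive v j i v∼j (symmetric i j i∼ʳj)))
      ; transitive = λ i j k i∼j j∼k → let (i∼ʳj , v≁i) = ∼-removeBlock⁻ {r} {v} i∼j ; (j∼ʳk , _) = ∼-removeBlock⁻ {r} {v} j∼k in
                       ∼-removeBlock⁺ {r} {v} (transitive i j k i∼ʳj j∼ʳk) v≁i
      ; mixed      = λ u w u∼w u≢w → let (u∼ʳw , v≁u) = ∼-removeBlock⁻ {r} {v} u∼w ; (z , u∼z , sides≢) = mixed u w u∼ʳw u≢w in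
                       z , ∼-removeBlock⁺ {r} {v} u∼z v≁u , sides≢ }

    addBlock-removeBlock : ∀ B → (∀ x → x ∈ B → v ∼[ r ] x) → (∀ x → v ∼[ r ] x → x ∈ B) →
      r ≡ addBlock B (removeBlock r v)
    addBlock-removeBlock B B⊆v v⊆B = matrix-ext r (addBlock B (removeBlock r v)) r⊆ ⊆r
      where
      r⊆ : ∀ i j → i ∼[ r ] j → i ∼[ addBlock B (removeBlock r v) ] j
      r⊆ i j i∼j with T? (lookup (lookup r v) i)
      ... | yes v∼i = ∼-addBlock⁺ {B} {removeBlock r v} (inj₁ (v⊆B i v∼i , v⊆B j (transitive v i j v∼i i∼j)))
      ... | no  v≁i = ∼-addBlock⁺ {B} {removeBlock r v} (inj₂ (∼-removeBlock⁺ {r} {v} i∼j v≁i))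
      ⊆r : ∀ i j → i ∼[ addBlock B (removeBlock r v) ] j → i ∼[ r ] j
      ⊆r i j i∼j with ∼-addBlock⁻ {B} {removeBlock r v} i∼j
      ... | inj₁ (i∈B , j∈B) = transitive i v j (symmetric v i (B⊆v i i∈B)) (B⊆v j j∈B)
      ... | inj₂ i∼′j        = proj₁ (∼-removeBlock⁻ {r} {v} i∼′j)

    withBlock-complete : ∀ t B R S →
      (∀ R′ {r′} → Unique R′ → length R′ ≤ t → GoodPartition (_∈ R′) r′ → r′ ∈ partitions t R′) →
      Separated B R S → v ∈ B → (∀ x → x ∈ B → v ∼[ r ] x) → (∀ x → x ∈ R → ¬ v ∼[ r ] x) →
      (∀ x → x ∈ W → In B R S x) → (∀ x → In B R S x → x ∈ W) → length R + length S ≤ t →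
      r ∈ withBlock t B R S
    withBlock-complete t B R [] partitions-complete sep v∈B B⊆v R≁v W⊆ ⊆W fuel =
      ∈-if-true connected (subst (_∈ map (addBlock B) (partitions t R)) (sym r≡) (∈-map⁺ (addBlock B) rest∈))
      where
      v⊆B : ∀ x → v ∼[ r ] x → x ∈ B
      v⊆B x v∼x with W⊆ x (support x v (symmetric v x v∼x))
      ... | inj₁ x∈B        = x∈B
      ... | inj₂ (inj₁ x∈R) = ⊥-elim (R≁v x x∈R v∼x)
      connected : T (connectedBlock B)
      connected = block-connected B (Separated.B! sep) v∈B B⊆v v⊆B
      rest⊆R : ∀ i → i ∈ W → ¬ v ∼[ r ] i → i ∈ R
      rest⊆R i i∈W v≁i with W⊆ i i∈W
      ... | inj₁ i∈B        = ⊥-elim (v≁i (B⊆v i i∈B))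
      ... | inj₂ (inj₁ i∈R) = i∈R
      rest∈ : removeBlock r v ∈ partitions t R
      rest∈ = partitions-complete R (Separated.R! sep) (subst (_≤ t) (+-identityʳ _) fuel)
        (removeBlock-good R (λ i i∈R → ⊆W i (inj₂ (inj₁ i∈R)) , R≁v i i∈R) rest⊆R)
      r≡ : r ≡ addBlock B (removeBlock r v)
      r≡ = addBlock-removeBlock B B⊆v v⊆B
    withBlock-complete t B R (x ∷ S) partitions-complete sep v∈B B⊆v R≁v W⊆ ⊆W fuel with T? (lookup (lookup r v) x)
    ... | yes v∼x = ∈-++⁺ˡ (withBlock-complete t (x ∷ B) R S partitions-complete (separated-block sep) (there v∈B)
                      (λ { y (here refl) → v∼x ; y (there y∈B) → B⊆v y y∈B }) R≁v
                      (λ y y∈W → In-block⁻ y (W⊆ y y∈W)) (λ y y∈ → ⊆W y (In-block⁺ y y∈)) (fuel-block R S x fuel))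
    ... | no  v≁x = ∈-++⁺ʳ (withBlock t (x ∷ B) R S)
                      (withBlock-complete t B (x ∷ R) S partitions-complete (separated-rest sep) v∈B B⊆v
                      (λ { y (here refl) → v≁x ; y (there y∈R) → R≁v y y∈R })
                      (λ y y∈W → In-rest⁻ y (W⊆ y y∈W)) (λ y y∈ → ⊆W y (In-rest⁺ y y∈)) (fuel-rest R S x fuel))

  partitions-complete : ∀ t S {r} → Unique S → length S ≤ t → GoodPartition (_∈ S) r → r ∈ partitions t S
  partitions-complete t [] {r} _ _ good = here (matrix-ext r emptyPartition
    (λ i j i∼j → case GoodPartition.support good i j i∼j of λ ())
    (λ i j i∼j → ⊥-elim (∼-matrixOf⁻ (λ _ _ → no (λ ())) i∼j)))
  partitions-complete (suc t) (v ∷ S) vS! (s≤s fuel) good =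
    Completeness.withBlock-complete good v t (v ∷ []) [] S (λ R′ → partitions-complete t R′) (separated-start vS!)
      (here refl) (λ { y (here refl) → GoodPartition.reflexive good v (here refl) }) (λ y ())
      In-start⁻ In-start⁺ fuel

  addBlock-injective : ∀ B R {r₁ r₂} → Disjoint B R → GoodPartition (_∈ R) r₁ → GoodPartition (_∈ R) r₂ →
    addBlock B r₁ ≡ addBlock B r₂ → r₁ ≡ r₂
  addBlock-injective B R {r₁} {r₂} B#R good₁ good₂ eq =
    matrix-ext r₁ r₂ (recover {r₁} {r₂} good₁ eq) (recover {r₂} {r₁} good₂ (sym eq))
    where
    recover : ∀ {r r′} → GoodPartition (_∈ R) r → addBlock B r ≡ addBlock B r′ → ∀ i j → i ∼[ r ] j → i ∼[ r′ ] j
    recover {r} {r′} good r≡r′ i j i∼j with ∼-addBlock⁻ {B} {r′} (subst (λ s → i ∼[ s ] j) r≡r′ (∼-addBlock⁺ {B} {r} (inj₂ i∼j)))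
    ... | inj₁ (i∈B , _) = ⊥-elim (B#R (i∈B , GoodPartition.support good i j i∼j))
    ... | inj₂ i∼′j      = i∼′j

  withBlock-block : ∀ t B R S {r} → r ∈ withBlock t B R S → ∀ y z → y ∈ B → z ∈ B → y ∼[ r ] z
  withBlock-block t B R [] r∈ y z y∈B z∈B with connectedBlock B
  ... | true = let (r′ , _ , r≡) = ∈-map⁻ (addBlock B) r∈ in
               subst (λ s → y ∼[ s ] z) (sym r≡) (∼-addBlock⁺ {B} {r′} (inj₁ (y∈B , z∈B)))
  withBlock-block t B R (x ∷ S) r∈ y z y∈B z∈B with ∈-++⁻ (withBlock t (x ∷ B) R S) r∈
  ... | inj₁ r∈ˡ = withBlock-block t (x ∷ B) R S r∈ˡ y z (there y∈B) (there z∈B)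
  ... | inj₂ r∈ʳ = withBlock-block t B (x ∷ R) S r∈ʳ y z y∈B z∈B

  withBlock-separates : ∀ t B R S {r} → (∀ R′ {r′} → Unique R′ → r′ ∈ partitions t R′ → GoodPartition (_∈ R′) r′) →
    Separated B R S → r ∈ withBlock t B R S → ∀ y z → y ∈ B → z ∈ R → ¬ y ∼[ r ] z
  withBlock-separates t B R [] partitions-sound sep r∈ y z y∈B z∈R y∼z with connectedBlock B
  ... | true with ∈-map⁻ (addBlock B) r∈
  ...   | r′ , r′∈ , refl with ∼-addBlock⁻ {B} {r′} y∼z
  ...     | inj₁ (_ , z∈B) = Separated.B#R sep (z∈B , z∈R)
  ...     | inj₂ y∼′z      = Separated.B#R sep (y∈B , GoodPartition.support (partitions-sound R (Separated.R! sep) r′∈) y z y∼′z)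
  withBlock-separates t B R (x ∷ S) partitions-sound sep r∈ y z y∈B z∈R y∼z with ∈-++⁻ (withBlock t (x ∷ B) R S) r∈
  ... | inj₁ r∈ˡ = withBlock-separates t (x ∷ B) R S partitions-sound (separated-block sep) r∈ˡ y z (there y∈B) z∈R y∼z
  ... | inj₂ r∈ʳ = withBlock-separates t B (x ∷ R) S partitions-sound (separated-rest sep) r∈ʳ y z y∈B (there z∈R) y∼z

  withBlock-unique : ∀ t B R S {v} → (∀ R′ → Unique R′ → Unique (partitions t R′)) →
    (∀ R′ {r′} → Unique R′ → r′ ∈ partitions t R′ → GoodPartition (_∈ R′) r′) →
    Separated B R S → v ∈ B → Unique (withBlock t B R S)
  withBlock-unique t B R [] partitions-unique partitions-sound sep v∈B with connectedBlock B
  ... | true  = map-unique (addBlock B) (partitions t R) (partitions-unique R R!) (λ r₁ r₂ r₁∈ r₂∈ →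
                  addBlock-injective B R B#R (partitions-sound R R! r₁∈) (partitions-sound R R! r₂∈))
    where open Separated sep
  ... | false = []
  withBlock-unique t B R (x ∷ S) {v} partitions-unique partitions-sound sep v∈B = ++⁺
    (withBlock-unique t (x ∷ B) R S partitions-unique partitions-sound (separated-block sep) (there v∈B))
    (withBlock-unique t B (x ∷ R) S partitions-unique partitions-sound (separated-rest sep) v∈B)
    -- the left list puts x in the block of v, the right one does not
    (λ { (r∈ˡ , r∈ʳ) → withBlock-separates t B (x ∷ R) S partitions-sound (separated-rest sep) r∈ʳ v x v∈B (here refl)
                         (withBlock-block t (x ∷ B) R S r∈ˡ v x (there v∈B) (here refl)) })

  partitions-unique : ∀ t S → Unique S → Unique (partitions t S)
  partitions-unique t       []      _   = All.[] ∷ []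
  partitions-unique zero    (v ∷ S) _   = []
  partitions-unique (suc t) (v ∷ S) vS! = withBlock-unique t (v ∷ []) [] S (partitions-unique t)
    (λ R′ R′! → partitions-sound t R′ R′!) (separated-start vS!) (here refl)

  #-++ : ∀ xs ys → #x (xs ++ ys) ≡ #x xs + #x ys × #y (xs ++ ys) ≡ #y xs + #y ys
  #-++ []       ys = refl , refl
  #-++ (v ∷ xs) ys with side v | #-++ xs ys
  ... | true  | #x≡ , #y≡ = cong suc #x≡ , #y≡
  ... | false | #x≡ , #y≡ = #x≡ , cong suc #y≡

  all-x : ∀ xs → (∀ y → y ∈ xs → side y ≡ true) → #x xs ≡ length xs × #y xs ≡ 0
  all-x []       _      = refl , refl
  all-x (v ∷ xs) x-side with side v in v-side | all-x xs (λ y y∈ → x-side y (there y∈))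
  ... | true  | #x≡ , #y≡ = cong suc #x≡ , #y≡
  ... | false | _         = ⊥-elim (true≢false (trans (sym (x-side v (here refl))) v-side))

  all-y : ∀ xs → (∀ y → y ∈ xs → side y ≡ false) → #x xs ≡ 0 × #y xs ≡ length xs
  all-y []       _      = refl , refl
  all-y (v ∷ xs) y-side with side v in v-side | all-y xs (λ y y∈ → y-side y (there y∈))
  ... | false | #x≡ , #y≡ = #x≡ , cong suc #y≡
  ... | true  | _         = ⊥-elim (true≢false (trans (sym v-side) (y-side v (here refl))))

  goodPartitions-count : ∀ S → Unique S → HasCount (GoodPartition (_∈ S)) (count (#x S) (#y S))
  goodPartitions-count S S! =
    partitions (length S) S , length-partitions (length S) S ≤-refl , partitions-unique (length S) S S! ,
    λ r → mk⇔ (partitions-sound (length S) S S!) (partitions-complete (length S) S S! ≤-refl)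

HasCount-resp : ∀ {A : Set} {P Q : A → Set} {c} → (∀ x → P x → Q x) → (∀ x → Q x → P x) →
  HasCount P c → HasCount Q c
HasCount-resp P⇒Q Q⇒P (xs , length≡ , xs! , ∈⇔P) =
  xs , length≡ , xs! , λ x → mk⇔ (P⇒Q x ∘ Equivalence.to (∈⇔P x)) (Equivalence.from (∈⇔P x) ∘ Q⇒P x)

-- The compositions of K_{m,n} are the good partitions for the colouring
-- "index below m", which lists the vertex set with m x-side and n y-side
-- vertices.
module CompleteBipartite (m n : ℕ) where

  isX : Fin (m + n) → Bool
  isX v = toℕ v <ᵇ m

  open Enumeration isX

  isX-true : ∀ v → toℕ v < m → isX v ≡ true
  isX-true v v<m = Equivalence.to T-≡ (<⇒<ᵇ v<m)

  isX-false : ∀ v → m ≤ toℕ v → isX v ≡ false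
  isX-false v m≤v with isX v in v-side
  ... | true  = ⊥-elim (<⇒≱ (<ᵇ⇒< (toℕ v) m (Equivalence.from T-≡ v-side)) m≤v)
  ... | false = refl

  isX-true⁻ : ∀ v → isX v ≡ true → toℕ v < m
  isX-true⁻ v v-side = <ᵇ⇒< (toℕ v) m (Equivalence.from T-≡ v-side)

  isX-false⁻ : ∀ v → isX v ≡ false → m ≤ toℕ v
  isX-false⁻ v v-side = ≮⇒≥ (λ v<m → true≢false (trans (sym (isX-true v v<m)) v-side))

  adjacent : ∀ a b → isX a ≢ isX b → Adj (K m n) a b
  adjacent a b sides≢ with isX a in a-side | isX b in b-side
  ... | true  | true  = ⊥-elim (sides≢ refl)
  ... | false | false = ⊥-elim (sides≢ refl)
  ... | true  | false = inj₁ (isX-true⁻ a a-side , isX-false⁻ b b-side)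
  ... | false | true  = inj₂ (isX-false⁻ a a-side , isX-true⁻ b b-side)

  adjacent⁻ : ∀ {a b} → Adj (K m n) a b → isX b ≢ isX a
  adjacent⁻ {a} {b} (inj₁ (a<m , m≤b)) sides≡ = true≢false (trans (sym (isX-true a a<m)) (trans (sym sides≡) (isX-false b m≤b)))
  adjacent⁻ {a} {b} (inj₂ (m≤a , b<m)) sides≡ = true≢false (trans (sym (isX-true b b<m)) (trans sides≡ (isX-false a m≤a)))

  xVertices yVertices vertices : List (Fin (m + n))
  xVertices = map (_↑ˡ n) (allFin m)
  yVertices = map (m ↑ʳ_) (allFin n)
  vertices  = xVertices ++ yVertices

  xVertices-x : ∀ v → v ∈ xVertices → isX v ≡ true
  xVertices-x v v∈ = let (a , _ , v≡) = ∈-map⁻ (_↑ˡ n) v∈ in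
    isX-true v (subst (_< m) (sym (trans (cong toℕ v≡) (toℕ-↑ˡ a n))) (toℕ<n a))

  yVertices-y : ∀ v → v ∈ yVertices → isX v ≡ false
  yVertices-y v v∈ = let (b , _ , v≡) = ∈-map⁻ (m ↑ʳ_) v∈ in
    isX-false v (subst (m ≤_) (sym (trans (cong toℕ v≡) (toℕ-↑ʳ m b))) (m≤m+n m (toℕ b)))

  vertices-complete : ∀ v → v ∈ vertices
  vertices-complete v with splitAt m v in split
  ... | inj₁ a = subst (_∈ vertices) (splitAt⁻¹-↑ˡ split) (∈-++⁺ˡ (∈-map⁺ (_↑ˡ n) (∈-allFin a)))
  ... | inj₂ b = subst (_∈ vertices) (splitAt⁻¹-↑ʳ split) (∈-++⁺ʳ xVertices (∈-map⁺ (m ↑ʳ_) (∈-allFin b)))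

  vertices-unique : Unique vertices
  vertices-unique = ++⁺ (map⁺ ↑ˡ-injective′ (allFin⁺ m)) (map⁺ (↑ʳ-injective m _ _) (allFin⁺ n))
    (λ { (v∈x , v∈y) → true≢false (trans (sym (xVertices-x _ v∈x)) (yVertices-y _ v∈y)) })
    where
    ↑ˡ-injective′ : ∀ {a b : Fin m} → a ↑ˡ n ≡ b ↑ˡ n → a ≡ b
    ↑ˡ-injective′ {a} {b} = ↑ˡ-injective n a b

  length-allFin-map : ∀ {k} (g : Fin k → Fin (m + n)) → length (map g (allFin k)) ≡ k
  length-allFin-map {k} g = trans (length-map g (allFin k)) (length-tabulate (λ i → i))

  #x-vertices : #x vertices ≡ m
  #x-vertices = begin
    #x vertices                  ≡⟨ proj₁ (#-++ xVertices yVertices) ⟩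
    #x xVertices + #x yVertices  ≡⟨ cong₂ _+_ (proj₁ (all-x xVertices xVertices-x)) (proj₁ (all-y yVertices yVertices-y)) ⟩
    length xVertices + 0         ≡⟨ +-identityʳ _ ⟩
    length xVertices             ≡⟨ length-allFin-map (_↑ˡ n) ⟩
    m                            ∎
    where open ≡-Reasoning

  #y-vertices : #y vertices ≡ n
  #y-vertices = begin
    #y vertices                  ≡⟨ proj₂ (#-++ xVertices yVertices) ⟩
    #y xVertices + #y yVertices  ≡⟨ cong₂ _+_ (proj₂ (all-x xVertices xVertices-x)) (proj₂ (all-y yVertices yVertices-y)) ⟩
    length yVertices             ≡⟨ length-allFin-map (m ↑ʳ_) ⟩
    n                            ∎
    where open ≡-Reasoning

  walk-start : ∀ {S : Fin (m + n) → Set} {a b} → WalkIn (K m n) S a b → S a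
  walk-start (here s)     = s
  walk-start (step s _ _) = s

  walk-other-side : ∀ {S : Fin (m + n) → Set} {a b} → WalkIn (K m n) S a b → a ≢ b →
    Σ (Fin (m + n)) λ z → S z × isX z ≢ isX a
  walk-other-side (here _)                    a≢b = ⊥-elim (a≢b refl)
  walk-other-side (step {v = z} _ a~z z⇝b) _  = z , walk-start z⇝b , adjacent⁻ a~z

  composition⇒good : ∀ r → IsComposition (K m n) r → GoodPartition (_∈ vertices) r
  composition⇒good r ((refl′ , sym′ , trans′) , walks) = record
    { support = λ i j _ → vertices-complete i ; reflexive = λ i _ → refl′ i
    ; symmetric = sym′ ; transitive = trans′ ; mixed = λ u w u∼w u≢w → walk-other-side (walks u w u∼w) u≢w }

  -- Within a good block, two vertices are joined by an edge or by a path
  -- of length two through a vertex of the other side.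
  good⇒composition : ∀ r → GoodPartition (_∈ vertices) r → IsComposition (K m n) r
  good⇒composition r good = ((λ i → reflexive i (vertices-complete i)) , symmetric , transitive) , walk
    where
    open GoodPartition good
    walk : ∀ u v → u ∼[ r ] v → WalkIn (K m n) (λ w → u ∼[ r ] w) u v
    walk u v u∼v with u ≟ᶠ v
    ... | yes refl = here (reflexive u (vertices-complete u))
    ... | no  u≢v with isX u ≟ᵇ isX v
    ...   | no  sides≢ = step (reflexive u (vertices-complete u)) (adjacent u v sides≢) (here u∼v)
    ...   | yes sides≡ = let (z , u∼z , z≢u) = mixed u v u∼v u≢v in
                         step (reflexive u (vertices-complete u)) (adjacent u z (λ e → z≢u (sym e)))
                              (step u∼z (adjacent z v (λ e → z≢u (trans e (sym sides≡)))) (here u∼v))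

  compositions-count : HasCount (IsComposition (K m n)) (count m n)
  compositions-count = subst₂ (λ a b → HasCount (IsComposition (K m n)) (count a b)) #x-vertices #y-vertices
    (HasCount-resp good⇒composition composition⇒good (goodPartitions-count vertices vertices-unique))

mainTheorem3 : (m n : ℕ) → Σ ℕ λ c → HasCount (IsComposition (K m n)) c
    × (expS F m n ≡ (+ c / (m ! * n !)) {{m !* n !≢0}})
mainTheorem3 m n = count m n , CompleteBipartite.compositions-count m n , expS-F-egf m n
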